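{- Let $\phi$ be an instance of \textsc{Max (2,3)-SAT} with $n$ variables and let $T_\phi$ be the \textsc{Tournament Value Maximization} instance constructed from $\phi$ as described in the context (the round-oblivious three-valued construction). If $\phi$ admits an assignment satisfying at least $k$ clauses, then $T_\phi$ has a seeding whose tournament value is at least $k+n$.
   Context: Tournament model: players are natural numbers forming a set $N$ with $|N|=2^{n'}$; player $i$ beats $j$ iff $i>j$. A seeding is a bijection $\sigma:N\to\{1,\dots,|N|\}$. In round $r=1,\dots,n'$, for each block of $2^r$ consecutive seed positions $\{(t-1)2^r+1,\dots,t2^r\}$, the winner $i_1$ of the first half (its strongest player) plays the winner $i_2$ of the second half with game value $v(i_1,i_2,r)$; the block winner is $\max(i_1,i_2)$. The tournament value is the sum of all game values. \textsc{Max (2,3)-SAT}: a Boolean formula $\phi$ in which each clause has exactly two literals and each variable appears in at most three clauses. Construction of $T_\phi$ from $\phi$ with variables $x_1,\dots,x_n$ and clauses $c_1,\dots,c_m$ (all game values are independent of the round and symmetric, written $v(a,b)=v(b,a)$): for each variable $x$ create players $x,x^T,x^F$ with $v(x,x^T)=v(x,x^F)=1$; for each clause $c$ a player $c$, and for each variable $x$ appearing in $c$: $v(c,x^T)=1$ if $x$ appears non-negated in $c$, and $v(c,x^F)=1$ if negated. For each $i\in\{1,\dots,n\}$ create special players $\widehat d_i,d_i,\widetilde d_i$ with $v(d_i,\widehat d_i)=v(d_i,\widetilde d_i)=v(d_i,x_i)=0$. Let $n'$ be smallest with $16n\le 2^{n'}$, $p=2^{n'}-16n$, and create dummy players $f_1,\dots,f_{10n+p-m}$.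 Strength order: $\widehat d_1>d_1>\widetilde d_1>\widehat d_2>d_2>\widetilde d_2>\dots>\widehat d_n>d_n>\widetilde d_n>x_1>x_1^T>x_1^F>x_2>\dots>x_n>x_n^T>x_n^F>c_1>\dots>c_m>f_1>\dots>f_{10n+p-m}$. For every $i$ and every player $Y$ for which the value was not set above, $v(d_i,Y)=v(x_i,Y)=-5$. All remaining pairs have value $0$. Thus the values lie in $\{0,1,-5\}$. -}

module Defs where

open import Data.Nat using (ℕ; zero; suc; _+_; _*_; _∸_; _^_; _≤_; _<_; _⊔_; _<ᵇ_; _≡ᵇ_)
open import Data.Nat.DivMod using (_/_; _%_)
open import Data.Integer using (ℤ; +_; -[1+_])
import Data.Integer as ℤ
open import Data.Fin using (Fin; toℕ; _↑ˡ_; _↑ʳ_)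
open import Data.Bool using (Bool; true; false; _∧_; _∨_; if_then_else_; not)
open import Data.List using (List; []; _∷_; length; filter)
open import Data.Product using (_×_; _,_)
open import Relation.Binary.PropositionalEquality using (_≡_; _≢_)
open import Relation.Nullary.Decidable using (Dec)
open import Data.Bool.Properties using (T?)
open import Data.Bool using (T)
open import Function using (_∘_)

-- Players are natural numbers; i beats j iff i > j.
-- A game-value function  v a b r  gives the value of a game between
-- a (winner of the first half) and b (winner of the second half) in round r.

GameValue : Set
GameValue = ℕ → ℕ → ℕ → ℤ

firstHalf : (r : ℕ) → Fin (2 ^ r) → Fin (2 ^ suc r)
firstHalf r i = i ↑ˡ (2 ^ r + 0)

secondHalf : (r : ℕ) → Fin (2 ^ r) → Fin (2 ^ suc r)
secondHalf r i = (2 ^ r) ↑ʳ (i ↑ˡ 0)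

winner : (r : ℕ) → (Fin (2 ^ r) → ℕ) → ℕ
winner zero    f = f Fin.zero
  where import Data.Fin as Fin
winner (suc r) f = winner r (f ∘ firstHalf r) ⊔ winner r (f ∘ secondHalf r)

-- total value of all games played inside a block of 2^r positions
-- (the final game of such a block is a game of round r)
blockValue : GameValue → (r : ℕ) → (Fin (2 ^ r) → ℕ) → ℤ
blockValue v zero    f = + 0
blockValue v (suc r) f =
  blockValue v r (f ∘ firstHalf r) ℤ.+ blockValue v r (f ∘ secondHalf r)
  ℤ.+ v (winner r (f ∘ firstHalf r)) (winner r (f ∘ secondHalf r)) (suc r)

-- Players of a tournament with 2^n' players are 0,…,2^n'-1 (as Fin).
-- A seeding σ is a bijection players → positions (positions 0-indexed);
-- the tournament value is the sum of all game values.
Seeding : ℕ → Set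
Seeding n' = Fin (2 ^ n') Function.Bundles.↔ Fin (2 ^ n')
  where import Function.Bundles

tournamentValue : (n' : ℕ) → GameValue → Seeding n' → ℤ
tournamentValue n' v σ = blockValue v n' (toℕ ∘ Inverse.from σ)
  where open import Function.Bundles using (Inverse)

-- a literal: a variable together with its sign (true = non-negated)
Literal : ℕ → Set
Literal n = Fin n × Bool

Clause : ℕ → Set
Clause n = Literal n × Literal n

TwoLiterals : {n : ℕ} → Clause n → Set
TwoLiterals (l₁ , l₂) = l₁ ≢ l₂

Formula : ℕ → Set
Formula n = List (Clause n)

occursIn : {n : ℕ} → Fin n → Clause n → Bool
occursIn i ((j₁ , _) , (j₂ , _)) = (toℕ i ≡ᵇ toℕ j₁) ∨ (toℕ i ≡ᵇ toℕ j₂)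

occurrences : {n : ℕ} → Fin n → Formula n → ℕ
occurrences i []       = 0
occurrences i (c ∷ cs) = (if occursIn i c then 1 else 0) + occurrences i cs

data AllTwoLiterals {n : ℕ} : Formula n → Set where
  []  : AllTwoLiterals []
  _∷_ : {c : Clause n} {cs : Formula n} → TwoLiterals c → AllTwoLiterals cs → AllTwoLiterals (c ∷ cs)

IsMax23SAT : {n : ℕ} → Formula n → Set
IsMax23SAT {n} φ = AllTwoLiterals φ × ((i : Fin n) → occurrences i φ ≤ 3)

Assignment : ℕ → Set
Assignment n = Fin n → Bool

litTrue : {n : ℕ} → Assignment n → Literal n → Bool
litTrue α (i , true)  = α i
litTrue α (i , false) = not (α i)

clauseSat : {n : ℕ} → Assignment n → Clause n → Bool
clauseSat α (l₁ , l₂) = litTrue α l₁ ∨ litTrue α l₂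

numSatisfied : {n : ℕ} → Assignment n → Formula n → ℕ
numSatisfied α []       = 0
numSatisfied α (c ∷ cs) = (if clauseSat α c then 1 else 0) + numSatisfied α cs

-- roles of the players (variable indices 0-based, clause indices 0-based)
data Role : Set where
  dhat d dtil : ℕ → Role
  var varT varF : ℕ → Role
  clause : ℕ → Role
  dummy : Role               -- f_k

-- role of the player of strength-rank q (rank 0 = strongest), following the
-- order  \hat d_1 > d_1 > \tilde d_1 > … > \tilde d_n > x_1 > x_1^T > x_1^F > …
--        > x_n^F > c_1 > … > c_m > f_1 > … ;  n variables, m clauses
roleOfRank : (n m q : ℕ) → Role
roleOfRank n m q =
  if q <ᵇ 3 * n then pick (q % 3) (q / 3) dhat d dtil
  else if q <ᵇ 6 * n then pick ((q ∸ 3 * n) % 3) ((q ∸ 3 * n) / 3) var varT varF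
  else if q <ᵇ 6 * n + m then clause (q ∸ 6 * n)
  else dummy
  where
  pick : ℕ → ℕ → (ℕ → Role) → (ℕ → Role) → (ℕ → Role) → Role
  pick zero          i a b c = a i
  pick (suc zero)    i a b c = b i
  pick (suc (suc _)) i a b c = c i

-- apply a test to the j-th clause (0-based) of the formula (false if absent)
lookupClause : {n : ℕ} → Formula n → ℕ → (Clause n → Bool) → Bool
lookupClause []       j       p = false
lookupClause (c ∷ cs) zero    p = p c
lookupClause (c ∷ cs) (suc j) p = lookupClause cs j p

signedIn : {n : ℕ} → ℕ → Bool → Clause n → Bool
signedIn i s ((j₁ , s₁) , (j₂ , s₂)) =
  ((i ≡ᵇ toℕ j₁) ∧ eqB s s₁) ∨ ((i ≡ᵇ toℕ j₂) ∧ eqB s s₂)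
  where
  eqB : Bool → Bool → Bool
  eqB true  true  = true
  eqB false false = true
  eqB _     _     = false

setOne : {n : ℕ} → Formula n → Role → Role → Bool
setOne φ (var i)    (varT j) = i ≡ᵇ j
setOne φ (var i)    (varF j) = i ≡ᵇ j
setOne φ (clause c) (varT i) = lookupClause φ c (signedIn i true)
setOne φ (clause c) (varF i) = lookupClause φ c (signedIn i false)
setOne φ _          _        = false

setZero : Role → Role → Bool
setZero (d i) (dhat j) = i ≡ᵇ j
setZero (d i) (dtil j) = i ≡ᵇ j
setZero (d i) (var j)  = i ≡ᵇ j
setZero _     _        = false

isDorX : Role → Bool
isDorX (d _)   = true
isDorX (var _) = true
isDorX _       = false

roleValue : {n : ℕ} → Formula n → Role → Role → ℤ
roleValue φ a b =
  if setOne φ a b ∨ setOne φ b a then + 1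
  else if setZero a b ∨ setZero b a then + 0
  else if isDorX a ∨ isDorX b then -[1+ 4 ]
  else + 0

Tφ : {n : ℕ} → Formula n → (n' : ℕ) → GameValue
Tφ {n} φ n' a b r =
  roleValue φ (roleOfRank n (length φ) (2 ^ n' ∸ 1 ∸ a))
              (roleOfRank n (length φ) (2 ^ n' ∸ 1 ∸ b))

IsSmallestExp : ℕ → ℕ → Set
IsSmallestExp n n' = (16 * n ≤ 2 ^ n') × ((k : ℕ) → k < n' → 2 ^ k < 16 * n)

-- Give every player a weight: 1 for the literal player of x_j that α makes false, 1 for every
-- clause player seated in the block of a variable whose literal satisfies it, 0 for the rest.
-- As every variable occurs in at most three clauses, every satisfied clause gets a seat, so the
-- weights add up to n plus the number of satisfied clauses. Each player except the champion
-- loses exactly one game, hence the tournament value is at least the total weight minus the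
-- champion's weight as soon as every game is worth at least the weight of its loser. One block
-- of 16 seeds per variable achieves this: inside it d_j and x_j only meet partners against which
-- the value is 0 or 1, the false literal loses to x_j and each seated clause loses to the true
-- literal in games worth 1, and d̂_j wins the block. Block winners and all players outside the
-- blocks are neither d_i nor x_i, so every remaining game is worth at least 0.
module Submission where

open import Defs
open import Data.Nat
  using (ℕ; zero; suc; _+_; _*_; _∸_; _^_; _≤_; _<_; _⊔_; _⊓_; _<ᵇ_; _≡ᵇ_; _<?_; z≤n; s≤s; s≤s⁻¹; NonZero)
open import Data.Nat.Properties
open import Data.Nat.DivMod using (_/_; _%_; m≡m%n+[m/n]*n; m%n<n; m<n*o⇒m/o<n; [m+kn]%n≡m%n; m<n⇒m%n≡m)
open import Data.Integer using (ℤ; +_)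
import Data.Integer as ℤ
import Data.Integer.Properties as ℤ
open import Data.Bool using (Bool; true; false; not; _∨_; if_then_else_; T)
open import Data.Bool.Properties using (T-≡; ∨-zeroʳ; not-injective)
open import Data.Fin using (Fin; toℕ; fromℕ<)
import Data.Fin as Fin
open import Data.Fin.Properties using (toℕ<n; fromℕ<-toℕ; toℕ-fromℕ<; toℕ-injective; toℕ-↑ˡ; toℕ-↑ʳ)
open import Data.Fin.Permutation using (Permutation; _⟨$⟩ʳ_; _⟨$⟩ˡ_; inverseˡ; inverseʳ; transpose; _∘ₚ_)
import Data.Fin.Permutation as Permutation
open import Data.List using ([]; _∷_; length)
open import Data.Maybe using (Maybe; just; nothing; maybe′; is-just; _>>=_)
open import Data.Maybe.Properties using (just-injective)
open import Data.Product using (Σ; _×_; _,_; proj₁; proj₂; map₂)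
open import Data.Sum using (_⊎_; inj₁; inj₂)
open import Data.Unit using (⊤; tt)
open import Function using (_∘_; Equivalence)
open import Relation.Nullary using (yes; no; ¬_)
open import Relation.Nullary.Negation using (contradiction)
open import Relation.Binary using (tri<; tri≈; tri>)
open import Relation.Binary.PropositionalEquality
import Algebra.Properties.CommutativeMonoid.Sum as CommutativeMonoidSum
import Algebra.Properties.CommutativeSemigroup as CommutativeSemigroupProperties

module FinSum = CommutativeMonoidSum +-0-commutativeMonoid
open CommutativeSemigroupProperties +-commutativeSemigroup using (interchange)
open CommutativeSemigroupProperties ℤ.+-commutativeSemigroup using () renaming (interchange to ℤ-interchange)

divMod-unique : ∀ {k t t′ j j′} .{{_ : NonZero k}} → t < k → t′ < k →
                t + j * k ≡ t′ + j′ * k → t ≡ t′ × j ≡ j′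
divMod-unique {k} {t} {t′} {j} {j′} t<k t′<k eq = t≡t′ , *-cancelʳ-≡ j j′ k (+-cancelˡ-≡ t _ _ eq′)
  where
  remainder : ∀ {s} i → s < k → (s + i * k) % k ≡ s
  remainder {s} i s<k = trans ([m+kn]%n≡m%n s i k) (m<n⇒m%n≡m s<k)
  t≡t′ = trans (sym (remainder j t<k)) (trans (cong (_% k) eq) (remainder j′ t′<k))
  eq′ = trans eq (cong (_+ j′ * k) (sym t≡t′))

divMod-of : ∀ {k t} j .{{_ : NonZero k}} → t < k → (t + j * k) % k ≡ t × (t + j * k) / k ≡ j
divMod-of {k} {t} j t<k =
  divMod-unique {j = (t + j * k) / k} {j′ = j} (m%n<n (t + j * k) k) t<k (sym (m≡m%n+[m/n]*n (t + j * k) k))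

divMod-bound : ∀ {k t j l} → t < k → j < l → t + j * k < l * k
divMod-bound {k} {t} {j} t<k j<l = <-≤-trans (+-monoˡ-< (j * k) t<k) (*-monoˡ-≤ k j<l)

≡ᵇ-refl : ∀ j → (j ≡ᵇ j) ≡ true
≡ᵇ-refl j = Equivalence.to T-≡ (≡⇒≡ᵇ j j refl)

<⇒<ᵇ≡true : ∀ {a b} → a < b → (a <ᵇ b) ≡ true
<⇒<ᵇ≡true {a} {b} a<b = Equivalence.to T-≡ (<⇒<ᵇ a<b)

<ᵇ≡true⇒< : ∀ {a b} → (a <ᵇ b) ≡ true → a < b
<ᵇ≡true⇒< {a} {b} eq = <ᵇ⇒< a b (Equivalence.from T-≡ eq)

<ᵇ≡false⇒≥ : ∀ {a b} → (a <ᵇ b) ≡ false → b ≤ a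
<ᵇ≡false⇒≥ eq = ≮⇒≥ λ a<b → subst T eq (<⇒<ᵇ a<b)

mirror-involutive : ∀ {k x} → x < k → k ∸ 1 ∸ (k ∸ 1 ∸ x) ≡ x
mirror-involutive {suc k} (s≤s x≤k) = m∸[m∸n]≡n x≤k

mirror-< : ∀ {k x} → x < k → k ∸ 1 ∸ x < k
mirror-< {suc k} {x} _ = s≤s (m∸n≤m k x)

mirror-antitone : ∀ {k q q′} → q < q′ → q′ < k → k ∸ 1 ∸ q′ < k ∸ 1 ∸ q
mirror-antitone {suc k} q<q′ (s≤s q′≤k) = ∸-monoʳ-< q<q′ q′≤k

bool-to-ℕ : Bool → ℕ
bool-to-ℕ b = if b then 1 else 0

-- Finite sums over initial segments of ℕ

∑< : ℕ → (ℕ → ℕ) → ℕ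
∑< zero    h = 0
∑< (suc k) h = h 0 + ∑< k (h ∘ suc)

syntax ∑< k (λ i → e) = ∑[ i < k ] e

∑-cong : ∀ k {h h′ : ℕ → ℕ} → (∀ i → i < k → h i ≡ h′ i) → ∑< k h ≡ ∑< k h′
∑-cong zero    eq = refl
∑-cong (suc k) eq = cong₂ _+_ (eq 0 (s≤s z≤n)) (∑-cong k (λ i i<k → eq (suc i) (s≤s i<k)))

∑-mono : ∀ k {h h′ : ℕ → ℕ} → (∀ i → i < k → h i ≤ h′ i) → ∑< k h ≤ ∑< k h′
∑-mono zero    le = z≤n
∑-mono (suc k) le = +-mono-≤ (le 0 (s≤s z≤n)) (∑-mono k (λ i i<k → le (suc i) (s≤s i<k)))

∑-split : ∀ a b (h : ℕ → ℕ) → ∑< (a + b) h ≡ ∑< a h + ∑[ i < b ] h (a + i)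
∑-split zero    b h = refl
∑-split (suc a) b h = trans (cong (_+_ (h 0)) (∑-split a b (h ∘ suc))) (sym (+-assoc (h 0) _ _))

∑-prefix : ∀ a b (h : ℕ → ℕ) → ∑< a h ≤ ∑< (a + b) h
∑-prefix a b h = subst (∑< a h ≤_) (sym (∑-split a b h)) (m≤m+n _ _)

∑-suffix : ∀ a b (h : ℕ → ℕ) → ∑[ i < b ] h (a + i) ≤ ∑< (a + b) h
∑-suffix a b h = subst (∑[ i < b ] h (a + i) ≤_) (sym (∑-split a b h)) (m≤n+m _ _)

∑-reverse : ∀ k (h : ℕ → ℕ) → ∑[ i < k ] h (k ∸ suc i) ≡ ∑< k h
∑-reverse zero    h = refl
∑-reverse (suc k) h = begin
  h k + ∑[ i < k ] h (k ∸ suc i)  ≡⟨ cong (_+_ (h k)) (∑-reverse k h) ⟩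
  h k + ∑< k h                    ≡⟨ +-comm (h k) _ ⟩
  ∑< k h + h k                    ≡⟨ cong (_+_ (∑< k h)) (trans (+-identityʳ _) (cong h (+-identityʳ k))) ⟨
  ∑< k h + ∑< 1 (λ i → h (k + i)) ≡⟨ ∑-split k 1 h ⟨
  ∑< (k + 1) h                    ≡⟨ cong (λ x → ∑< x h) (+-comm k 1) ⟩
  ∑< (suc k) h                    ∎
  where open ≡-Reasoning

∑-distrib-+ : ∀ k (h h′ : ℕ → ℕ) → ∑[ i < k ] (h i + h′ i) ≡ ∑< k h + ∑< k h′
∑-distrib-+ zero    h h′ = refl
∑-distrib-+ (suc k) h h′ =
  trans (cong (_+_ (h 0 + h′ 0)) (∑-distrib-+ k (h ∘ suc) (h′ ∘ suc))) (interchange (h 0) (h′ 0) _ _)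

∑-const : ∀ k c → ∑[ i < k ] c ≡ k * c
∑-const zero    c = refl
∑-const (suc k) c = cong (_+_ c) (∑-const k c)

term≤∑ : ∀ k (h : ℕ → ℕ) {i} → i < k → h i ≤ ∑< k h
term≤∑ (suc k) h {zero}  _         = m≤m+n _ _
term≤∑ (suc k) h {suc i} (s≤s i<k) = ≤-trans (term≤∑ k (h ∘ suc) i<k) (m≤n+m _ _)

∑-blocks : ∀ k b (h : ℕ → ℕ) → ∑< (k * b) h ≡ ∑[ j < k ] ∑[ t < b ] h (t + j * b)
∑-blocks zero    b h = refl
∑-blocks (suc k) b h = begin
  ∑< (b + k * b) h                                   ≡⟨ ∑-split b (k * b) h ⟩
  ∑< b h + ∑[ i < k * b ] h (b + i)
      ≡⟨ cong₂ _+_ (∑-cong b (λ t _ → cong h (sym (+-identityʳ t)))) (∑-blocks k b (λ i → h (b + i))) ⟩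
  ∑[ t < b ] h (t + 0) + ∑[ j < k ] ∑[ t < b ] h (b + (t + j * b))
      ≡⟨ cong (_+_ _) (∑-cong k (λ j _ → ∑-cong b (λ t _ → cong h (shuffle t j)))) ⟩
  ∑[ t < b ] h (t + 0) + ∑[ j < k ] ∑[ t < b ] h (t + suc j * b) ∎
  where
  open ≡-Reasoning
  shuffle : ∀ t j → b + (t + j * b) ≡ t + (b + j * b)
  shuffle t j = trans (sym (+-assoc b t _)) (trans (cong (_+ j * b) (+-comm b t)) (+-assoc t b _))

∑-fin : ∀ k {f : Fin k → ℕ} {h : ℕ → ℕ} → (∀ i → f i ≡ h (toℕ i)) → FinSum.sum f ≡ ∑< k h
∑-fin zero    eq = refl
∑-fin (suc k) eq = cong₂ _+_ (eq Fin.zero) (∑-fin k (eq ∘ Fin.suc))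

-- Tournaments on seedings given as functions from positions to players

module Tournament (v : GameValue) where

  shift : ℕ → (ℕ → ℕ) → ℕ → ℕ
  shift o F i = F (o + i)

  champion : ℕ → (ℕ → ℕ) → ℕ
  champion zero    F = F 0
  champion (suc r) F = champion r F ⊔ champion r (shift (2 ^ r) F)

  value : ℕ → (ℕ → ℕ) → ℤ
  value zero    F = + 0
  value (suc r) F = value r F ℤ.+ value r (shift (2 ^ r) F)
                    ℤ.+ v (champion r F) (champion r (shift (2 ^ r) F)) (suc r)

  champion-cong : ∀ r {F G} → (∀ i → F i ≡ G i) → champion r F ≡ champion r G
  champion-cong zero    eq = eq 0
  champion-cong (suc r) eq = cong₂ _⊔_ (champion-cong r eq) (champion-cong r (eq ∘ (_+_ (2 ^ r))))

  winner≡champion×blockValue≡value : ∀ r {f : Fin (2 ^ r) → ℕ} {F} → (∀ i → f i ≡ F (toℕ i)) →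
                                     winner r f ≡ champion r F × blockValue v r f ≡ value r F
  winner≡champion×blockValue≡value zero    eq = eq Fin.zero , refl
  winner≡champion×blockValue≡value (suc r) {f} {F} eq =
    cong₂ _⊔_ (proj₁ left) (proj₁ right) ,
    cong₂ ℤ._+_ (cong₂ ℤ._+_ (proj₂ left) (proj₂ right)) (cong₂ (λ a b → v a b (suc r)) (proj₁ left) (proj₁ right))
    where
    left  = winner≡champion×blockValue≡value r λ i → trans (eq _) (cong F (toℕ-↑ˡ i _))
    right = winner≡champion×blockValue≡value r λ i →
              trans (eq _) (cong F (trans (toℕ-↑ʳ (2 ^ r) _) (cong (_+_ (2 ^ r)) (toℕ-↑ˡ i 0))))

  module Weighted (g : ℕ → ℕ) where

    Pays : ℕ → ℕ → ℕ → Set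
    Pays r a b = + g (a ⊓ b) ℤ.≤ v a b r

    AllPay : ℕ → (ℕ → ℕ) → Set
    AllPay zero    F = ⊤
    AllPay (suc r) F = AllPay r F × AllPay r (shift (2 ^ r) F) ×
                       Pays (suc r) (champion r F) (champion r (shift (2 ^ r) F))

    weight-⊓+⊔ : ∀ a b → g (a ⊓ b) + g (a ⊔ b) ≡ g a + g b
    weight-⊓+⊔ a b with ≤-total a b
    ... | inj₁ a≤b rewrite m≤n⇒m⊓n≡m a≤b | m≤n⇒m⊔n≡n a≤b = refl
    ... | inj₂ b≤a rewrite m≥n⇒m⊓n≡n b≤a | m≥n⇒m⊔n≡m b≤a = +-comm (g b) (g a)

    -- Each player but the champion loses exactly one game, and that game pays for its weight.
    ∑weight≤value+champion : ∀ r F → AllPay r F →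
                             + ∑[ i < 2 ^ r ] g (F i) ℤ.≤ value r F ℤ.+ + g (champion r F)
    ∑weight≤value+champion zero    F _ = ℤ.+≤+ (≤-reflexive (+-identityʳ _))
    ∑weight≤value+champion (suc r) F (pays₁ , pays₂ , pays) = begin
      + ∑[ i < 2 ^ suc r ] g (F i)
        ≡⟨ cong +_ (∑-split (2 ^ r) _ (g ∘ F)) ⟩
      + (∑[ i < 2 ^ r ] g (F i) + ∑< (2 ^ r + 0) (g ∘ F₂))
        ≡⟨ cong (λ k → + (∑< (2 ^ r) (g ∘ F) + ∑< k (g ∘ F₂))) (+-identityʳ (2 ^ r)) ⟩
      + ∑< (2 ^ r) (g ∘ F) ℤ.+ + ∑< (2 ^ r) (g ∘ F₂)
        ≤⟨ ℤ.+-mono-≤ (∑weight≤value+champion r F pays₁) (∑weight≤value+champion r F₂ pays₂) ⟩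
      (value r F ℤ.+ + g a) ℤ.+ (value r F₂ ℤ.+ + g b)
        ≡⟨ ℤ-interchange (value r F) (+ g a) _ _ ⟩
      (value r F ℤ.+ value r F₂) ℤ.+ (+ g a ℤ.+ + g b)
        ≡⟨ cong (λ x → (value r F ℤ.+ value r F₂) ℤ.+ + x) (weight-⊓+⊔ a b) ⟨
      (value r F ℤ.+ value r F₂) ℤ.+ (+ g (a ⊓ b) ℤ.+ + g (a ⊔ b))
        ≤⟨ ℤ.+-monoʳ-≤ (value r F ℤ.+ value r F₂) (ℤ.+-monoˡ-≤ (+ g (a ⊔ b)) pays) ⟩
      (value r F ℤ.+ value r F₂) ℤ.+ (v a b (suc r) ℤ.+ + g (a ⊔ b))
        ≡⟨ ℤ.+-assoc (value r F ℤ.+ value r F₂) _ _ ⟨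
      value (suc r) F ℤ.+ + g (champion (suc r) F)
        ∎
      where
      open ℤ.≤-Reasoning
      F₂ = shift (2 ^ r) F
      a  = champion r F
      b  = champion r F₂

    AllPay-cong : ∀ r {F G} → (∀ i → F i ≡ G i) → AllPay r F → AllPay r G
    AllPay-cong zero    eq _ = tt
    AllPay-cong (suc r) eq (pays₁ , pays₂ , pays) =
      AllPay-cong r eq pays₁ , AllPay-cong r (eq ∘ _+_ (2 ^ r)) pays₂ ,
      subst₂ (Pays (suc r)) (champion-cong r eq) (champion-cong r (eq ∘ _+_ (2 ^ r))) pays

    record Bracket (r : ℕ) (F : ℕ → ℕ) (P : ℕ → Set) : Set where
      constructor bracket
      field
        allPay         : AllPay r F
        champion-holds : P (champion r F)

    Bracket-cong : ∀ r {F G P} → (∀ i → F i ≡ G i) → Bracket r F P → Bracket r G P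
    Bracket-cong r {P = P} eq (bracket pays p) = bracket (AllPay-cong r eq pays) (subst P (champion-cong r eq) p)

    -- A record rather than a function type, so that join infers P, Q and R from it.
    record Match (P Q R : ℕ → Set) : Set where
      constructor match
      field play : ∀ {r a b} → P a → Q b → Pays r a b × R (a ⊔ b)

    Bracket-map : ∀ {r F P Q} → (∀ a → P a → Q a) → Bracket r F P → Bracket r F Q
    Bracket-map f (bracket pays p) = bracket pays (f _ p)

    leaf : ∀ {F P} → P (F 0) → Bracket 0 F P
    leaf p = bracket tt p

    join : ∀ {r F P Q R} → Match P Q R → Bracket r F P → Bracket r (shift (2 ^ r) F) Q → Bracket (suc r) F R
    join {r} (match play) (bracket pays₁ p) (bracket pays₂ q) =
      let pays , r-winner = play {suc r} p q in bracket (pays₁ , pays₂ , pays) r-winner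

    join-blocks : ∀ r s {F P} → Match P P P → (∀ b → b < 2 ^ r → Bracket s (shift (b * 2 ^ s) F) P) →
                  Bracket (r + s) F P
    join-blocks zero    s closed blocks = blocks 0 (s≤s z≤n)
    join-blocks (suc r) s {F} {P} closed blocks =
      join closed (join-blocks r s closed λ b b<2^r → blocks b (≤-trans b<2^r (m≤m+n _ _)))
           (join-blocks r s closed λ b b<2^r →
              Bracket-cong s {P = P} (λ i → cong F (position≡ b i))
                (blocks (2 ^ r + b) (+-monoʳ-< (2 ^ r) (≤-trans b<2^r (m≤m+n _ 0)))))
      where
      open ≡-Reasoning
      position≡ : ∀ b i → (2 ^ r + b) * 2 ^ s + i ≡ 2 ^ (r + s) + (b * 2 ^ s + i)
      position≡ b i = begin
        (2 ^ r + b) * 2 ^ s + i          ≡⟨ cong (_+ i) (*-distribʳ-+ (2 ^ s) (2 ^ r) b) ⟩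
        (2 ^ r * 2 ^ s + b * 2 ^ s) + i  ≡⟨ +-assoc (2 ^ r * 2 ^ s) _ _ ⟩
        2 ^ r * 2 ^ s + (b * 2 ^ s + i)  ≡⟨ cong (_+ (b * 2 ^ s + i)) (^-distribˡ-+-* 2 r s) ⟨
        2 ^ (r + s) + (b * 2 ^ s + i)    ∎

-- Extending a partial injection to a permutation

transpose-fixes : ∀ {N} (i j k : Fin N) → k ≢ i → k ≢ j → transpose i j ⟨$⟩ʳ k ≡ k
transpose-fixes i j k k≢i k≢j with k Fin.≟ i
... | yes k≡i = contradiction k≡i k≢i
... | no _ with k Fin.≟ j
...   | yes k≡j = contradiction k≡j k≢j
...   | no _    = refl

transpose-sends : ∀ {N} (i j : Fin N) → transpose i j ⟨$⟩ʳ i ≡ j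
transpose-sends i j with i Fin.≟ i
... | yes _   = refl
... | no i≢i = contradiction refl i≢i

module _ {N : ℕ} (P : ℕ → Maybe ℕ)
         (P-bounded : ∀ {a p} → a < N → P a ≡ just p → p < N)
         (P-injective : ∀ {a b p} → a < N → b < N → P a ≡ just p → P b ≡ just p → a ≡ b) where

  Realises : Permutation N N → ℕ → Set
  Realises π k = ∀ (a : Fin N) {p} → toℕ a < k → P (toℕ a) ≡ just p → toℕ (π ⟨$⟩ʳ a) ≡ p

  -- When P k = just p, follow π by the transposition of π k and p: no earlier element is sent
  -- to π k (π is injective) or to p (P is injective), so they all keep their images.
  realise : ∀ k → k ≤ N → Σ (Permutation N N) (λ π → Realises π k)
  realise zero    _   = Permutation.id , λ _ ()
  realise (suc k) k<N with realise k (<⇒≤ k<N) | P k in Pk≡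
  ... | π , π-realises | nothing = π , extend
    where
    extend : Realises π (suc k)
    extend a a<1+k Pa≡ with m≤n⇒m<n∨m≡n (s≤s⁻¹ a<1+k)
    ... | inj₁ a<k  = π-realises a a<k Pa≡
    ... | inj₂ refl with () ← trans (sym Pk≡) Pa≡
  ... | π , π-realises | just p = π′ , extend
    where
    k′ = fromℕ< k<N
    p′ = fromℕ< (P-bounded k<N Pk≡)
    τ = transpose (π ⟨$⟩ʳ k′) p′
    π′ = π ∘ₚ τ
    extend : Realises π′ (suc k)
    extend a {q} a<1+k Pa≡ with m≤n⇒m<n∨m≡n (s≤s⁻¹ a<1+k)
    ... | inj₁ a<k = trans (cong toℕ (transpose-fixes _ _ _ πa≢πk πa≢p)) (π-realises a a<k Pa≡)
      where
      πa≢πk : π ⟨$⟩ʳ a ≢ π ⟨$⟩ʳ k′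
      πa≢πk eq = <-irrefl (trans (cong toℕ a≡k′) (toℕ-fromℕ< k<N)) a<k
        where a≡k′ = trans (sym (inverseˡ π)) (trans (cong (Permutation._⟨$⟩ˡ_ π) eq) (inverseˡ π))
      πa≢p : π ⟨$⟩ʳ a ≢ p′
      πa≢p eq = <-irrefl (P-injective (toℕ<n a) k<N (subst (λ x → P (toℕ a) ≡ just x) q≡p Pa≡) Pk≡) a<k
        where q≡p = trans (sym (π-realises a a<k Pa≡)) (trans (cong toℕ eq) (toℕ-fromℕ< _))
    ... | inj₂ a≡k = begin
      toℕ (τ ⟨$⟩ʳ (π ⟨$⟩ʳ a))   ≡⟨ cong (λ x → toℕ (τ ⟨$⟩ʳ (π ⟨$⟩ʳ x))) a≡k′ ⟩
      toℕ (τ ⟨$⟩ʳ (π ⟨$⟩ʳ k′))  ≡⟨ cong toℕ (transpose-sends (π ⟨$⟩ʳ k′) p′) ⟩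
      toℕ p′                   ≡⟨ toℕ-fromℕ< _ ⟩
      p                        ≡⟨ just-injective (trans (sym Pk≡) (trans (cong P (sym a≡k)) Pa≡)) ⟩
      q                        ∎
      where
      open ≡-Reasoning
      a≡k′ = toℕ-injective (trans a≡k (sym (toℕ-fromℕ< k<N)))

  extend-to-permutation : Σ (Permutation N N) λ π → ∀ (a : Fin N) {p} → P (toℕ a) ≡ just p → toℕ (π ⟨$⟩ʳ a) ≡ p
  extend-to-permutation with realise N ≤-refl
  ... | π , π-realises = π , λ a → π-realises a (toℕ<n a)

-- Ranks, seats and weights of the players of T_φ

tier : Role → ℕ
tier (dhat _)   = 0
tier (d _)      = 0
tier (dtil _)   = 0
tier (var _)    = 1
tier (varT _)   = 1
tier (varF _)   = 1
tier (clause _) = 2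
tier dummy      = 3

-- The local pick of Defs.roleOfRank, which is not exported.
pickRole : ℕ → ℕ → (ℕ → Role) → (ℕ → Role) → (ℕ → Role) → Role
pickRole zero          j a b c = a j
pickRole (suc zero)    j a b c = b j
pickRole (suc (suc _)) j a b c = c j

literal : Bool → ℕ → Role
literal true  = varT
literal false = varF

module Construction {n : ℕ} (φ : Formula n) (α : Assignment n) where

  m : ℕ
  m = length φ

  data RankView (q : ℕ) : Set where
    dRank      : ∀ t j → t < 3 → j < n → q ≡ t + j * 3 →
                 roleOfRank n m q ≡ pickRole t j dhat d dtil → RankView q
    xRank      : ∀ t j → t < 3 → j < n → q ≡ 3 * n + (t + j * 3) →
                 roleOfRank n m q ≡ pickRole t j var varT varF → RankView q
    clauseRank : ∀ c → c < m → q ≡ 6 * n + c → roleOfRank n m q ≡ clause c → RankView q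
    dummyRank  : 6 * n + m ≤ q → roleOfRank n m q ≡ dummy → RankView q

  6n≡3n+3n : 6 * n ≡ 3 * n + 3 * n
  6n≡3n+3n = *-distribʳ-+ n 3 3

  rankView : ∀ q → RankView q
  rankView q with q <ᵇ 3 * n in q<3n
  ... | true = dRank (q % 3) (q / 3) (m%n<n q 3) (m<n*o⇒m/o<n q<n*3) (m≡m%n+[m/n]*n q 3) role≡
    where
    q<n*3 = subst (q <_) (*-comm 3 n) (<ᵇ≡true⇒< q<3n)
    role≡ : roleOfRank n m q ≡ pickRole (q % 3) (q / 3) dhat d dtil
    role≡ rewrite q<3n with q % 3
    ... | 0 = refl
    ... | 1 = refl
    ... | suc (suc _) = refl
  ... | false with q <ᵇ 6 * n in q<6n
  ...   | true = xRank (q′ % 3) (q′ / 3) (m%n<n q′ 3) (m<n*o⇒m/o<n q′<n*3) q≡ role≡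
    where
    q′ = q ∸ 3 * n
    3n≤q : 3 * n ≤ q
    3n≤q = <ᵇ≡false⇒≥ q<3n
    q′<n*3 : q′ < n * 3
    q′<n*3 = subst (q′ <_) (*-comm 3 n) (+-cancelˡ-< (3 * n) q′ (3 * n)
               (subst₂ _<_ (sym (m+[n∸m]≡n 3n≤q)) 6n≡3n+3n (<ᵇ≡true⇒< q<6n)))
    q≡ = trans (sym (m+[n∸m]≡n 3n≤q)) (cong (_+_ (3 * n)) (m≡m%n+[m/n]*n q′ 3))
    role≡ : roleOfRank n m q ≡ pickRole (q′ % 3) (q′ / 3) var varT varF
    role≡ rewrite q<3n | q<6n with q′ % 3
    ... | 0 = refl
    ... | 1 = refl
    ... | suc (suc _) = refl
  ...   | false with q <ᵇ 6 * n + m in q<6n+m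
  ...     | true = clauseRank (q ∸ 6 * n) c<m (sym (m+[n∸m]≡n 6n≤q)) role≡
    where
    6n≤q : 6 * n ≤ q
    6n≤q = <ᵇ≡false⇒≥ q<6n
    c<m = +-cancelˡ-< (6 * n) _ _ (subst (_< 6 * n + m) (sym (m+[n∸m]≡n 6n≤q))
                                     (<ᵇ≡true⇒< q<6n+m))
    role≡ : roleOfRank n m q ≡ clause (q ∸ 6 * n)
    role≡ rewrite q<3n | q<6n | q<6n+m = refl
  ...     | false = dummyRank (<ᵇ≡false⇒≥ q<6n+m) role≡
    where
    role≡ : roleOfRank n m q ≡ dummy
    role≡ rewrite q<3n | q<6n | q<6n+m = refl

  tier-dRole : ∀ t j → tier (pickRole t j dhat d dtil) ≡ 0
  tier-dRole zero          j = refl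
  tier-dRole (suc zero)    j = refl
  tier-dRole (suc (suc _)) j = refl

  tier-xRole : ∀ t j → tier (pickRole t j var varT varF) ≡ 1
  tier-xRole zero          j = refl
  tier-xRole (suc zero)    j = refl
  tier-xRole (suc (suc _)) j = refl

  -- roleOfRank fills [0, 3n), [3n, 6n), [6n, 6n + m) and [6n + m, …) with the roles of tier 0, 1, 2, 3.
  tierStart : ℕ → ℕ
  tierStart 0 = 0
  tierStart 1 = 3 * n
  tierStart 2 = 6 * n
  tierStart _ = 6 * n + m

  3n≤6n : 3 * n ≤ 6 * n
  3n≤6n = *-monoˡ-≤ n (m≤m+n 3 3)

  tierStart-mono : ∀ {t t′} → t ≤ t′ → tierStart t ≤ tierStart t′
  tierStart-mono {0}                 _ = z≤n
  tierStart-mono {1} {1}             _ = ≤-refl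
  tierStart-mono {1} {2}             _ = 3n≤6n
  tierStart-mono {1} {suc (suc (suc _))} _ = ≤-trans 3n≤6n (m≤m+n _ _)
  tierStart-mono {2} {2}             _ = ≤-refl
  tierStart-mono {2} {suc (suc (suc _))} _ = m≤m+n _ _
  tierStart-mono {suc (suc (suc _))} {suc (suc (suc _))} _ = ≤-refl
  tierStart-mono {1} {0} ()
  tierStart-mono {2} {0} ()
  tierStart-mono {2} {1} (s≤s ())
  tierStart-mono {suc (suc (suc _))} {0} ()
  tierStart-mono {suc (suc (suc _))} {1} (s≤s ())
  tierStart-mono {suc (suc (suc _))} {2} (s≤s (s≤s ()))

  tierStart≤rank : ∀ q → tierStart (tier (roleOfRank n m q)) ≤ q
  tierStart≤rank q with rankView q
  ... | dRank t j _ _ _ role≡ rewrite role≡ | tier-dRole t j = z≤n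
  ... | xRank t j _ _ q≡ role≡ rewrite role≡ | tier-xRole t j = subst (3 * n ≤_) (sym q≡) (m≤m+n _ _)
  ... | clauseRank c _ q≡ role≡ rewrite role≡ = subst (6 * n ≤_) (sym q≡) (m≤m+n _ _)
  ... | dummyRank 6n+m≤q role≡ rewrite role≡ = 6n+m≤q

  6n≤rank : ∀ {q} → 2 ≤ tier (roleOfRank n m q) → 6 * n ≤ q
  6n≤rank {q} 2≤tier = ≤-trans (tierStart-mono 2≤tier) (tierStart≤rank q)

  rank-of-dummy : ∀ {q} → roleOfRank n m q ≡ dummy → 6 * n + m ≤ q
  rank-of-dummy {q} role≡ = subst (λ R → tierStart (tier R) ≤ q) role≡ (tierStart≤rank q)

  rank-of-clause : ∀ {q c} → roleOfRank n m q ≡ clause c → q < 6 * n + m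
  rank-of-clause {q} role≡ with rankView q
  ... | dRank t j _ _ _ role≡′ with () ← trans (sym (cong tier (trans (sym role≡′) role≡))) (tier-dRole t j)
  ... | xRank t j _ _ _ role≡′ with () ← trans (sym (cong tier (trans (sym role≡′) role≡))) (tier-xRole t j)
  ... | clauseRank _ c<m q≡ _ = subst (_< 6 * n + m) (sym q≡) (+-monoʳ-< (6 * n) c<m)
  ... | dummyRank _ role≡′ with () ← trans (sym role≡′) role≡

  dRank<3n : ∀ {t j} → t < 3 → j < n → t + j * 3 < 3 * n
  dRank<3n {t} {j} t<3 j<n = subst (t + j * 3 <_) (*-comm n 3) (divMod-bound t<3 j<n)

  xRank<6n : ∀ {t j} → t < 3 → j < n → 3 * n + (t + j * 3) < 6 * n
  xRank<6n {t} {j} t<3 j<n = subst (3 * n + (t + j * 3) <_) (sym 6n≡3n+3n) (+-monoʳ-< (3 * n) (dRank<3n t<3 j<n))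

  roleOfRank-d : ∀ {t j} → t < 3 → j < n → roleOfRank n m (t + j * 3) ≡ pickRole t j dhat d dtil
  roleOfRank-d {t} {j} t<3 j<n with rankView (t + j * 3)
  ... | dRank _ j′ t′<3 _ q≡ role≡ with divMod-unique {j = j} {j′ = j′} t<3 t′<3 q≡
  ...   | refl , refl = role≡
  roleOfRank-d t<3 j<n | xRank _ _ _ _ q≡ _ =
    contradiction (subst (3 * n ≤_) (sym q≡) (m≤m+n _ _)) (<⇒≱ (dRank<3n t<3 j<n))
  roleOfRank-d t<3 j<n | clauseRank _ _ q≡ _ =
    contradiction (subst (3 * n ≤_) (sym q≡) (≤-trans 3n≤6n (m≤m+n _ _))) (<⇒≱ (dRank<3n t<3 j<n))
  roleOfRank-d t<3 j<n | dummyRank 6n+m≤q _ =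
    contradiction (≤-trans (≤-trans 3n≤6n (m≤m+n _ _)) 6n+m≤q) (<⇒≱ (dRank<3n t<3 j<n))

  roleOfRank-x : ∀ {t j} → t < 3 → j < n → roleOfRank n m (3 * n + (t + j * 3)) ≡ pickRole t j var varT varF
  roleOfRank-x {t} {j} t<3 j<n with rankView (3 * n + (t + j * 3))
  ... | xRank _ j′ t′<3 _ q≡ role≡ with divMod-unique {j = j} {j′ = j′} t<3 t′<3 (+-cancelˡ-≡ (3 * n) _ _ q≡)
  ...   | refl , refl = role≡
  roleOfRank-x t<3 j<n | dRank _ _ t′<3 j′<n q≡ _ =
    contradiction (m≤m+n _ _) (<⇒≱ (subst (_< 3 * n) (sym q≡) (dRank<3n t′<3 j′<n)))
  roleOfRank-x t<3 j<n | clauseRank _ _ q≡ _ =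
    contradiction (subst (6 * n ≤_) (sym q≡) (m≤m+n _ _)) (<⇒≱ (xRank<6n t<3 j<n))
  roleOfRank-x t<3 j<n | dummyRank 6n+m≤q _ =
    contradiction (≤-trans (m≤m+n _ _) 6n+m≤q) (<⇒≱ (xRank<6n t<3 j<n))

  roleOfRank-clause : ∀ {c} → c < m → roleOfRank n m (6 * n + c) ≡ clause c
  roleOfRank-clause {c} c<m with rankView (6 * n + c)
  ... | clauseRank _ _ q≡ role≡ with +-cancelˡ-≡ (6 * n) _ _ q≡
  ...   | refl = role≡
  roleOfRank-clause c<m | dRank _ _ t<3 j<n q≡ _ =
    contradiction (≤-trans 3n≤6n (m≤m+n _ _)) (<⇒≱ (subst (_< 3 * n) (sym q≡) (dRank<3n t<3 j<n)))
  roleOfRank-clause c<m | xRank _ _ t<3 j<n q≡ _ =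
    contradiction (m≤m+n _ _) (<⇒≱ (subst (_< 6 * n) (sym q≡) (xRank<6n t<3 j<n)))
  roleOfRank-clause c<m | dummyRank 6n+m≤q _ = contradiction 6n+m≤q (<⇒≱ (+-monoʳ-< (6 * n) c<m))

  roleOfRank-dummy : ∀ {q} → 6 * n + m ≤ q → roleOfRank n m q ≡ dummy
  roleOfRank-dummy {q} 6n+m≤q with rankView q
  ... | dummyRank _ role≡ = role≡
  ... | dRank _ _ t<3 j<n q≡ _ =
    contradiction (≤-trans (≤-trans 3n≤6n (m≤m+n _ _)) 6n+m≤q) (<⇒≱ (subst (_< 3 * n) (sym q≡) (dRank<3n t<3 j<n)))
  ... | xRank _ _ t<3 j<n q≡ _ =
    contradiction (≤-trans (m≤m+n _ _) 6n+m≤q) (<⇒≱ (subst (_< 6 * n) (sym q≡) (xRank<6n t<3 j<n)))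
  ... | clauseRank _ c<m q≡ _ =
    contradiction 6n+m≤q (<⇒≱ (subst (_< 6 * n + m) (sym q≡) (+-monoʳ-< (6 * n) c<m)))

  valueOf : ℕ → Bool
  valueOf j with j <? n
  ... | yes j<n = α (fromℕ< j<n)
  ... | no _    = false

  valueOf-toℕ : ∀ i → valueOf (toℕ i) ≡ α i
  valueOf-toℕ i with toℕ i <? n
  ... | yes i<n = cong α (fromℕ<-toℕ i i<n)
  ... | no i≮n  = contradiction (toℕ<n i) i≮n

  trueLiteral falseLiteral : ℕ → Role
  trueLiteral  j = literal (valueOf j) j
  falseLiteral j = literal (not (valueOf j)) j

  literalOffset : Bool → ℕ
  literalOffset b = if b then 1 else 2

  literalOffset<3 : ∀ b → literalOffset b < 3
  literalOffset<3 true  = s≤s (s≤s z≤n)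
  literalOffset<3 false = s≤s (s≤s (s≤s z≤n))

  roleOfRank-literal : ∀ b {j} → j < n → roleOfRank n m (3 * n + (literalOffset b + j * 3)) ≡ literal b j
  roleOfRank-literal true  j<n = roleOfRank-x (literalOffset<3 true) j<n
  roleOfRank-literal false j<n = roleOfRank-x (literalOffset<3 false) j<n

  designee : Clause n → Maybe ℕ
  designee ((i₁ , s₁) , (i₂ , s₂)) =
    if litTrue α (i₁ , s₁) then just (toℕ i₁) else if litTrue α (i₂ , s₂) then just (toℕ i₂) else nothing

  clauseAt : Formula n → ℕ → Maybe (Clause n)
  clauseAt []       _       = nothing
  clauseAt (c ∷ cs) zero    = just c
  clauseAt (c ∷ cs) (suc i) = clauseAt cs i

  designeeIn : Formula n → ℕ → Maybe ℕ
  designeeIn ψ c = clauseAt ψ c >>= designee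

  designeeOf : ℕ → Maybe ℕ
  designeeOf = designeeIn φ

  designates : ℕ → Maybe ℕ → ℕ
  designates j (just j′) = bool-to-ℕ (j′ ≡ᵇ j)
  designates j nothing   = 0

  designations : ℕ → ℕ → ℕ
  designations j c = ∑[ c′ < c ] designates j (designeeOf c′)

  clauseSlot : ℕ → ℕ
  clauseSlot 0 = 9
  clauseSlot 1 = 10
  clauseSlot _ = 12

  dummySlot : ℕ → ℕ
  dummySlot 0 = 11
  dummySlot 1 = 13
  dummySlot 2 = 14
  dummySlot _ = 15

  -- The bound keeps seat injective for arbitrary formulas; for (2,3)-formulas it always holds.
  clauseSeatFor : ℕ → Maybe ℕ → Maybe ℕ
  clauseSeatFor c (just j) =
    if designations j c <ᵇ 3 then just (clauseSlot (designations j c) + j * 16) else nothing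
  clauseSeatFor c nothing  = nothing

  clauseSeat : ℕ → Maybe ℕ
  clauseSeat c = clauseSeatFor c (designeeOf c)

  dummySeat : ℕ → Maybe ℕ
  dummySeat e = if e <ᵇ 4 * n then just (dummySlot (e % 4) + (e / 4) * 16) else nothing

  -- Block j holds d_j, d̃_j, x_j, false literal | d̂_j,
  -- three free slots | true literal, clause, clause, dummy, clause, dummy, dummy, dummy; its clauses
  -- are those designated to x_j, in order.
  seatOf : Role → ℕ → Maybe ℕ
  seatOf (dhat j)   _ = just (4 + j * 16)
  seatOf (d j)      _ = just (0 + j * 16)
  seatOf (dtil j)   _ = just (1 + j * 16)
  seatOf (var j)    _ = just (2 + j * 16)
  seatOf (varT j)   _ = just ((if valueOf j then 8 else 3) + j * 16)
  seatOf (varF j)   _ = just ((if valueOf j then 3 else 8) + j * 16)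
  seatOf (clause c) _ = clauseSeat c
  seatOf dummy      q = dummySeat (q ∸ (6 * n + m))

  seat : ℕ → Maybe ℕ
  seat q = seatOf (roleOfRank n m q) q

  -- What the player is guaranteed to earn in the game it loses: the false literal loses to x_j,
  -- a seated clause loses to the true literal of its variable, both in games worth 1.
  weight : Role → ℕ
  weight (varT j)   = if valueOf j then 0 else 1
  weight (varF j)   = if valueOf j then 1 else 0
  weight (clause c) = bool-to-ℕ (is-just (clauseSeat c))
  weight _          = 0

  weight≤1 : ∀ R → weight R ≤ 1
  weight≤1 (dhat _)   = z≤n
  weight≤1 (d _)      = z≤n
  weight≤1 (dtil _)   = z≤n
  weight≤1 (var _)    = z≤n
  weight≤1 (varT j)   with valueOf j
  ... | true  = z≤n
  ... | false = ≤-refl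
  weight≤1 (varF j)   with valueOf j
  ... | true  = ≤-refl
  ... | false = z≤n
  weight≤1 (clause c) with is-just (clauseSeat c)
  ... | true  = ≤-refl
  ... | false = z≤n
  weight≤1 dummy      = z≤n

  designates-self : ∀ j → designates j (just j) ≡ 1
  designates-self j = cong bool-to-ℕ (≡ᵇ-refl j)

  designations-suc : ∀ {j c} → designeeOf c ≡ just j → designations j (suc c) ≡ suc (designations j c)
  designations-suc {j} {c} des≡ = begin
    designations j (suc c)                                  ≡⟨ cong (designations j) (+-comm 1 c) ⟩
    designations j (c + 1)                                  ≡⟨ ∑-split c 1 _ ⟩
    designations j c + (designates j (designeeOf (c + 0)) + 0)
                       ≡⟨ cong (λ x → designations j c + (designates j (designeeOf x) + 0)) (+-identityʳ c) ⟩
    designations j c + (designates j (designeeOf c) + 0)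
                       ≡⟨ cong (λ x → designations j c + (designates j x + 0)) des≡ ⟩
    designations j c + (designates j (just j) + 0)
                       ≡⟨ cong (λ x → designations j c + (x + 0)) (designates-self j) ⟩
    designations j c + 1                                    ≡⟨ +-comm (designations j c) 1 ⟩
    suc (designations j c)                                  ∎
    where open ≡-Reasoning

  designations-mono : ∀ j {c c′} → c ≤ c′ → designations j c ≤ designations j c′
  designations-mono j {c} c≤c′ =
    subst (λ x → designations j c ≤ designations j x) (m+[n∸m]≡n c≤c′) (∑-prefix c _ _)

  designations-< : ∀ {j c c′} → c < c′ → designeeOf c ≡ just j → designations j c < designations j c′
  designations-< {j} {c′ = c′} c<c′ des≡ =
    subst (_≤ designations j c′) (designations-suc des≡) (designations-mono j c<c′)

  designations-injective : ∀ {j c c′} → designeeOf c ≡ just j → designeeOf c′ ≡ just j →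
                      designations j c ≡ designations j c′ → c ≡ c′
  designations-injective {c = c} {c′} des≡ des≡′ eq with <-cmp c c′
  ... | tri< c<c′ _ _ = contradiction eq (<⇒≢ (designations-< c<c′ des≡))
  ... | tri≈ _ c≡c′ _ = c≡c′
  ... | tri> _ _ c′<c = contradiction (sym eq) (<⇒≢ (designations-< c′<c des≡′))

  designee<n : ∀ cl {j} → designee cl ≡ just j → j < n
  designee<n ((i₁ , s₁) , (i₂ , s₂)) des≡ with litTrue α (i₁ , s₁) | litTrue α (i₂ , s₂)
  ... | true  | _     = subst (_< n) (just-injective des≡) (toℕ<n i₁)
  ... | false | true  = subst (_< n) (just-injective des≡) (toℕ<n i₂)
  ... | false | false with () ← des≡

  designeeOf<n : ∀ c {j} → designeeOf c ≡ just j → j < n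
  designeeOf<n c des≡ with clauseAt φ c
  ... | just cl = designee<n cl des≡

  data Seated (j : ℕ) : ℕ → ℕ → Set where
    dhat-seat    : Seated j 4 (0 + j * 3)
    d-seat       : Seated j 0 (1 + j * 3)
    dtil-seat    : Seated j 1 (2 + j * 3)
    var-seat     : Seated j 2 (3 * n + (0 + j * 3))
    false-seat   : ∀ {b} → valueOf j ≡ not b → Seated j 3 (3 * n + (literalOffset b + j * 3))
    true-seat    : ∀ {b} → valueOf j ≡ b → Seated j 8 (3 * n + (literalOffset b + j * 3))
    clause-seat₀ : ∀ {c} → c < m → designeeOf c ≡ just j → designations j c ≡ 0 → Seated j 9 (6 * n + c)
    clause-seat₁ : ∀ {c} → c < m → designeeOf c ≡ just j → designations j c ≡ 1 → Seated j 10 (6 * n + c)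
    clause-seat₂ : ∀ {c} → c < m → designeeOf c ≡ just j → designations j c ≡ 2 → Seated j 12 (6 * n + c)
    dummy-seat₀  : Seated j 11 (6 * n + m + (0 + j * 4))
    dummy-seat₁  : Seated j 13 (6 * n + m + (1 + j * 4))
    dummy-seat₂  : Seated j 14 (6 * n + m + (2 + j * 4))
    dummy-seat₃  : Seated j 15 (6 * n + m + (3 + j * 4))

  clause-rank-unique : ∀ {j k c c′} → designeeOf c ≡ just j → designeeOf c′ ≡ just j →
                       designations j c ≡ k → designations j c′ ≡ k → 6 * n + c ≡ 6 * n + c′
  clause-rank-unique des≡ des≡′ k≡ k≡′ = cong (_+_ (6 * n)) (designations-injective des≡ des≡′ (trans k≡ (sym k≡′)))

  Seated-unique : ∀ {j s q q′} → Seated j s q → Seated j s q′ → q ≡ q′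
  Seated-unique dhat-seat         dhat-seat          = refl
  Seated-unique d-seat            d-seat             = refl
  Seated-unique dtil-seat         dtil-seat          = refl
  Seated-unique var-seat          var-seat           = refl
  Seated-unique {j} (false-seat v≡) (false-seat v≡′) =
    cong (λ b → 3 * n + (literalOffset b + j * 3)) (not-injective (trans (sym v≡) v≡′))
  Seated-unique {j} (true-seat v≡)  (true-seat v≡′)  =
    cong (λ b → 3 * n + (literalOffset b + j * 3)) (trans (sym v≡) v≡′)
  Seated-unique (clause-seat₀ _ des≡ k≡) (clause-seat₀ _ des≡′ k≡′) = clause-rank-unique des≡ des≡′ k≡ k≡′
  Seated-unique (clause-seat₁ _ des≡ k≡) (clause-seat₁ _ des≡′ k≡′) = clause-rank-unique des≡ des≡′ k≡ k≡′
  Seated-unique (clause-seat₂ _ des≡ k≡) (clause-seat₂ _ des≡′ k≡′) = clause-rank-unique des≡ des≡′ k≡ k≡′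
  Seated-unique dummy-seat₀       dummy-seat₀        = refl
  Seated-unique dummy-seat₁       dummy-seat₁        = refl
  Seated-unique dummy-seat₂       dummy-seat₂        = refl
  Seated-unique dummy-seat₃       dummy-seat₃        = refl

  record Placement (q p : ℕ) : Set where
    constructor placement
    field
      block slot : ℕ
      block<n    : block < n
      slot<16    : slot < 16
      position≡  : p ≡ slot + block * 16
      seated     : Seated block slot q

  dRank-placement : ∀ {t j p} → t < 3 → j < n → seatOf (pickRole t j dhat d dtil) (t + j * 3) ≡ just p →
                    Placement (t + j * 3) p
  dRank-placement {0} _ j<n seat≡ = placement _ 4 j<n (<ᵇ⇒< 4 16 _) (sym (just-injective seat≡)) dhat-seat
  dRank-placement {1} _ j<n seat≡ = placement _ 0 j<n (<ᵇ⇒< 0 16 _) (sym (just-injective seat≡)) d-seat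
  dRank-placement {2} _ j<n seat≡ = placement _ 1 j<n (<ᵇ⇒< 1 16 _) (sym (just-injective seat≡)) dtil-seat
  dRank-placement {suc (suc (suc _))} (s≤s (s≤s (s≤s ()))) _ _

  xRank-placement : ∀ {t j p} → t < 3 → j < n → seatOf (pickRole t j var varT varF) (3 * n + (t + j * 3)) ≡ just p →
                    Placement (3 * n + (t + j * 3)) p
  xRank-placement {0} _ j<n seat≡ = placement _ 2 j<n (<ᵇ⇒< 2 16 _) (sym (just-injective seat≡)) var-seat
  xRank-placement {1} {j} _ j<n seat≡ with valueOf j in v≡
  ... | true  = placement j 8 j<n (<ᵇ⇒< 8 16 _) (sym (just-injective seat≡)) (true-seat v≡)
  ... | false = placement j 3 j<n (<ᵇ⇒< 3 16 _) (sym (just-injective seat≡)) (false-seat v≡)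
  xRank-placement {2} {j} _ j<n seat≡ with valueOf j in v≡
  ... | true  = placement j 3 j<n (<ᵇ⇒< 3 16 _) (sym (just-injective seat≡)) (false-seat v≡)
  ... | false = placement j 8 j<n (<ᵇ⇒< 8 16 _) (sym (just-injective seat≡)) (true-seat v≡)
  xRank-placement {suc (suc (suc _))} (s≤s (s≤s (s≤s ()))) _ _

  clause-placement : ∀ {c p x} → c < m → designeeOf c ≡ x → clauseSeatFor c x ≡ just p → Placement (6 * n + c) p
  clause-placement {c} {x = just j} c<m des≡ seat≡ with designations j c in before≡
  ... | 0 = placement j 9 (designeeOf<n c des≡) (<ᵇ⇒< 9 16 _) (sym (just-injective seat≡)) (clause-seat₀ c<m des≡ before≡)
  ... | 1 = placement j 10 (designeeOf<n c des≡) (<ᵇ⇒< 10 16 _) (sym (just-injective seat≡)) (clause-seat₁ c<m des≡ before≡)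
  ... | 2 = placement j 12 (designeeOf<n c des≡) (<ᵇ⇒< 12 16 _) (sym (just-injective seat≡)) (clause-seat₂ c<m des≡ before≡)

  dummy-placement : ∀ {q p} → 6 * n + m ≤ q → dummySeat (q ∸ (6 * n + m)) ≡ just p → Placement q p
  dummy-placement {q} {p} 6n+m≤q seat≡ with e <ᵇ 4 * n in e<4n
    where e = q ∸ (6 * n + m)
  ... | true = bySlot (e % 4) refl (just-injective seat≡)
    where
    e = q ∸ (6 * n + m)
    j<n : e / 4 < n
    j<n = m<n*o⇒m/o<n (subst (e <_) (*-comm 4 n) (<ᵇ≡true⇒< e<4n))
    q≡ : ∀ {t} → e % 4 ≡ t → q ≡ 6 * n + m + (t + (e / 4) * 4)
    q≡ refl = trans (sym (m+[n∸m]≡n 6n+m≤q)) (cong (_+_ (6 * n + m)) (m≡m%n+[m/n]*n e 4))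
    at : ∀ {t} → dummySlot t < 16 → e % 4 ≡ t → dummySlot t + (e / 4) * 16 ≡ p →
         Seated (e / 4) (dummySlot t) (6 * n + m + (t + (e / 4) * 4)) → Placement q p
    at s<16 r≡ p≡ seated = placement (e / 4) _ j<n s<16 (sym p≡) (subst (Seated _ _) (sym (q≡ r≡)) seated)
    bySlot : ∀ t → e % 4 ≡ t → dummySlot t + (e / 4) * 16 ≡ p → Placement q p
    bySlot 0 r≡ p≡ = at (<ᵇ⇒< 11 16 _) r≡ p≡ dummy-seat₀
    bySlot 1 r≡ p≡ = at (<ᵇ⇒< 13 16 _) r≡ p≡ dummy-seat₁
    bySlot 2 r≡ p≡ = at (<ᵇ⇒< 14 16 _) r≡ p≡ dummy-seat₂
    bySlot 3 r≡ p≡ = at (<ᵇ⇒< 15 16 _) r≡ p≡ dummy-seat₃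
    bySlot (suc (suc (suc (suc t)))) r≡ _ = contradiction (m≤m+n 4 t) (<⇒≱ (subst (_< 4) r≡ (m%n<n e 4)))

  placement-of : ∀ {q p} → seat q ≡ just p → Placement q p
  placement-of {q} {p} seat≡ with rankView q
  ... | dRank t j t<3 j<n refl role≡ = dRank-placement t<3 j<n (subst (λ R → seatOf R q ≡ just p) role≡ seat≡)
  ... | xRank t j t<3 j<n refl role≡ = xRank-placement t<3 j<n (subst (λ R → seatOf R q ≡ just p) role≡ seat≡)
  ... | clauseRank c c<m refl role≡ = clause-placement c<m refl (subst (λ R → seatOf R q ≡ just p) role≡ seat≡)
  ... | dummyRank 6n+m≤q role≡ = dummy-placement 6n+m≤q (subst (λ R → seatOf R q ≡ just p) role≡ seat≡)

  seat-injective : ∀ {q q′ p} → seat q ≡ just p → seat q′ ≡ just p → q ≡ q′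
  seat-injective seat≡ seat≡′ with placement-of seat≡ | placement-of seat≡′
  ... | placement j s _ s<16 p≡ seated | placement j′ s′ _ s′<16 p≡′ seated′
    with divMod-unique {j = j} {j′ = j′} s<16 s′<16 (trans (sym p≡) p≡′)
  ...   | refl , refl = Seated-unique seated seated′

  seat<16n : ∀ {q p} → seat q ≡ just p → p < 16 * n
  seat<16n seat≡ with placement-of seat≡
  ... | placement j s j<n s<16 refl _ = subst (s + j * 16 <_) (*-comm n 16) (divMod-bound s<16 j<n)

  seat-dhat : ∀ {j} → j < n → seat (0 + j * 3) ≡ just (4 + j * 16)
  seat-dhat {j} j<n = cong (λ R → seatOf R (0 + j * 3)) (roleOfRank-d (<ᵇ⇒< 0 3 _) j<n)

  seat-d : ∀ {j} → j < n → seat (1 + j * 3) ≡ just (0 + j * 16)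
  seat-d {j} j<n = cong (λ R → seatOf R (1 + j * 3)) (roleOfRank-d (<ᵇ⇒< 1 3 _) j<n)

  seat-dtil : ∀ {j} → j < n → seat (2 + j * 3) ≡ just (1 + j * 16)
  seat-dtil {j} j<n = cong (λ R → seatOf R (2 + j * 3)) (roleOfRank-d (<ᵇ⇒< 2 3 _) j<n)

  seat-var : ∀ {j} → j < n → seat (3 * n + (0 + j * 3)) ≡ just (2 + j * 16)
  seat-var {j} j<n = cong (λ R → seatOf R (3 * n + (0 + j * 3))) (roleOfRank-x (<ᵇ⇒< 0 3 _) j<n)

  seat-trueLiteral : ∀ {j} → j < n → seat (3 * n + (literalOffset (valueOf j) + j * 3)) ≡ just (8 + j * 16)
  seat-trueLiteral {j} j<n rewrite roleOfRank-literal (valueOf j) j<n with valueOf j in v≡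
  ... | true  rewrite v≡ = refl
  ... | false rewrite v≡ = refl

  seat-falseLiteral : ∀ {j} → j < n → seat (3 * n + (literalOffset (not (valueOf j)) + j * 3)) ≡ just (3 + j * 16)
  seat-falseLiteral {j} j<n rewrite roleOfRank-literal (not (valueOf j)) j<n with valueOf j in v≡
  ... | true  rewrite v≡ = refl
  ... | false rewrite v≡ = refl

  seat-dummy : ∀ {t j} → t < 4 → j < n → seat (6 * n + m + (t + j * 4)) ≡ just (dummySlot t + j * 16)
  seat-dummy {t} {j} t<4 j<n rewrite roleOfRank-dummy (m≤m+n (6 * n + m) (t + j * 4))
                                    | m+n∸m≡n (6 * n + m) (t + j * 4)
                                    | <⇒<ᵇ≡true (subst (t + j * 4 <_) (*-comm n 4) (divMod-bound t<4 j<n))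
                                    | proj₁ (divMod-of j t<4) | proj₂ (divMod-of j t<4) = refl

  unseated-weak : ∀ R {q} → seatOf R q ≡ nothing → 2 ≤ tier R × weight R ≡ 0
  unseated-weak (clause c) seat≡ = ≤-refl , cong (bool-to-ℕ ∘ is-just) seat≡
  unseated-weak dummy      _     = m≤m+n 2 1 , refl
  unseated-weak (varT j) seat≡ with () ← seat≡
  unseated-weak (varF j) seat≡ with () ← seat≡

  lookupClause≡ : ∀ ψ c (p : Clause n → Bool) → lookupClause ψ c p ≡ maybe′ p false (clauseAt ψ c)
  lookupClause≡ []       c       p = refl
  lookupClause≡ (_ ∷ ψ) zero    p = refl
  lookupClause≡ (_ ∷ ψ) (suc c) p = lookupClause≡ ψ c p

  litTrue⇒sign : ∀ i s → litTrue α (i , s) ≡ true → α i ≡ s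
  litTrue⇒sign i true  holds = holds
  litTrue⇒sign i false holds = not-injective holds

  signedIn-designee : ∀ cl {j} → designee cl ≡ just j → signedIn j (valueOf j) cl ≡ true
  signedIn-designee ((i₁ , s₁) , (i₂ , s₂)) des≡ with litTrue α (i₁ , s₁) in holds₁
  ... | true rewrite sym (just-injective des≡) | valueOf-toℕ i₁ | litTrue⇒sign i₁ s₁ holds₁
                   | ≡ᵇ-refl (toℕ i₁) with s₁
  ...   | true  = refl
  ...   | false = refl
  signedIn-designee ((i₁ , s₁) , (i₂ , s₂)) des≡ | false with litTrue α (i₂ , s₂) in holds₂
  ... | true rewrite sym (just-injective des≡) | valueOf-toℕ i₂ | litTrue⇒sign i₂ s₂ holds₂
                   | ≡ᵇ-refl (toℕ i₂) with s₂
  ...   | true  = ∨-zeroʳ _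
  ...   | false = ∨-zeroʳ _
  signedIn-designee ((i₁ , s₁) , (i₂ , s₂)) des≡ | false | false with () ← des≡

  designee-setOne : ∀ {c j} → designeeOf c ≡ just j → setOne φ (clause c) (trueLiteral j) ≡ true
  designee-setOne {c} {j} des≡ = trans (setOne-literal (valueOf j)) (trans (lookupClause≡ φ c _) holds)
    where
    setOne-literal : ∀ b → setOne φ (clause c) (literal b j) ≡ lookupClause φ c (signedIn j b)
    setOne-literal true  = refl
    setOne-literal false = refl
    holds : maybe′ (signedIn j (valueOf j)) false (clauseAt φ c) ≡ true
    holds with clauseAt φ c
    ... | just cl = signedIn-designee cl des≡

  variable-weight : ∀ {j} → j < n → ∑[ t < 3 ] weight (roleOfRank n m (3 * n + (t + j * 3))) ≡ 1
  variable-weight {j} j<n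
    rewrite roleOfRank-x {0} (<ᵇ⇒< 0 3 _) j<n | roleOfRank-x {1} (<ᵇ⇒< 1 3 _) j<n | roleOfRank-x {2} (<ᵇ⇒< 2 3 _) j<n
    with valueOf j
  ... | true  = refl
  ... | false = refl

  variables-weight : ∑[ i < 3 * n ] weight (roleOfRank n m (3 * n + i)) ≡ n
  variables-weight = begin
    ∑[ i < 3 * n ] weight (roleOfRank n m (3 * n + i))
                                                        ≡⟨ cong (λ k → ∑[ i < k ] weight (roleOfRank n m (3 * n + i))) (*-comm 3 n) ⟩
    ∑[ i < n * 3 ] weight (roleOfRank n m (3 * n + i))  ≡⟨ ∑-blocks n 3 _ ⟩
    ∑[ j < n ] ∑[ t < 3 ] weight (roleOfRank n m (3 * n + (t + j * 3)))  ≡⟨ ∑-cong n (λ j j<n → variable-weight j<n) ⟩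
    ∑[ j < n ] 1                                        ≡⟨ ∑-const n 1 ⟩
    n * 1                                               ≡⟨ *-identityʳ n ⟩
    n                                                   ∎
    where open ≡-Reasoning

  occursAt : ℕ → Clause n → Bool
  occursAt j ((i₁ , _) , (i₂ , _)) = (j ≡ᵇ toℕ i₁) ∨ (j ≡ᵇ toℕ i₂)

  occurrencesAt : ℕ → Formula n → ℕ
  occurrencesAt j []       = 0
  occurrencesAt j (c ∷ cs) = bool-to-ℕ (occursAt j c) + occurrencesAt j cs

  occurrencesAt-toℕ : ∀ i ψ → occurrencesAt (toℕ i) ψ ≡ occurrences i ψ
  occurrencesAt-toℕ i []                          = refl
  occurrencesAt-toℕ i (((_ , _) , (_ , _)) ∷ ψ) = cong (_+_ _) (occurrencesAt-toℕ i ψ)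

  designates≤occursAt : ∀ j cl → designates j (designee cl) ≤ bool-to-ℕ (occursAt j cl)
  designates≤occursAt j ((i₁ , s₁) , (i₂ , s₂)) with litTrue α (i₁ , s₁)
  ... | true with toℕ i₁ ≡ᵇ j in i₁≡j
  ...   | false = z≤n
  ...   | true rewrite sym (≡ᵇ⇒≡ (toℕ i₁) j (Equivalence.from T-≡ i₁≡j)) | ≡ᵇ-refl (toℕ i₁) = ≤-refl
  designates≤occursAt j ((i₁ , s₁) , (i₂ , s₂)) | false with litTrue α (i₂ , s₂)
  ... | false = z≤n
  ... | true with toℕ i₂ ≡ᵇ j in i₂≡j
  ...   | false = z≤n
  ...   | true rewrite sym (≡ᵇ⇒≡ (toℕ i₂) j (Equivalence.from T-≡ i₂≡j)) | ≡ᵇ-refl (toℕ i₂)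
                     | ∨-zeroʳ (toℕ i₂ ≡ᵇ toℕ i₁) = ≤-refl

  designations≤occurrences : ∀ j ψ → ∑[ c < length ψ ] designates j (designeeIn ψ c) ≤ occurrencesAt j ψ
  designations≤occurrences j []       = z≤n
  designations≤occurrences j (cl ∷ ψ) = +-mono-≤ (designates≤occursAt j cl) (designations≤occurrences j ψ)

  OccursAtMostThrice : Set
  OccursAtMostThrice = ∀ i → occurrences i φ ≤ 3

  occurrencesAt≤3 : OccursAtMostThrice → ∀ {j} → j < n → occurrencesAt j φ ≤ 3
  occurrencesAt≤3 occ≤3 {j} j<n = subst (_≤ 3) occurrences≡ (occ≤3 (fromℕ< j<n))
    where
    occurrences≡ : occurrences (fromℕ< j<n) φ ≡ occurrencesAt j φ
    occurrences≡ = trans (sym (occurrencesAt-toℕ (fromℕ< j<n) φ)) (cong (λ x → occurrencesAt x φ) (toℕ-fromℕ< j<n))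

  designations<3 : OccursAtMostThrice → ∀ {c j} → c < m → designeeOf c ≡ just j → designations j c < 3
  designations<3 occ≤3 {c} {j} c<m des≡ = <-≤-trans (designations-< c<m des≡)
    (≤-trans (designations≤occurrences j φ) (occurrencesAt≤3 occ≤3 (designeeOf<n c des≡)))

  clause-weight : OccursAtMostThrice → ∀ {c} → c < m → weight (clause c) ≡ bool-to-ℕ (is-just (designeeOf c))
  clause-weight occ≤3 {c} c<m = seated refl
    where
    seated : ∀ {x} → designeeOf c ≡ x → bool-to-ℕ (is-just (clauseSeatFor c x)) ≡ bool-to-ℕ (is-just x)
    seated {nothing} _    = refl
    seated {just j}  des≡ rewrite <⇒<ᵇ≡true (designations<3 occ≤3 c<m des≡) = refl

  designee-satisfied : ∀ cl → is-just (designee cl) ≡ clauseSat α cl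
  designee-satisfied ((i₁ , s₁) , (i₂ , s₂)) with litTrue α (i₁ , s₁) | litTrue α (i₂ , s₂)
  ... | true  | _     = refl
  ... | false | true  = refl
  ... | false | false = refl

  satisfied-count : ∀ ψ → ∑[ c < length ψ ] bool-to-ℕ (is-just (designeeIn ψ c)) ≡ numSatisfied α ψ
  satisfied-count []       = refl
  satisfied-count (cl ∷ ψ) = cong₂ _+_ (cong bool-to-ℕ (designee-satisfied cl)) (satisfied-count ψ)

  clauses-weight : OccursAtMostThrice → ∑[ c < m ] weight (roleOfRank n m (6 * n + c)) ≡ numSatisfied α φ
  clauses-weight occ≤3 = trans (∑-cong m λ c c<m → trans (cong weight (roleOfRank-clause c<m)) (clause-weight occ≤3 c<m))
                               (satisfied-count φ)

  length≤∑occurrences : ∀ ψ → length ψ ≤ ∑[ j < n ] occurrencesAt j ψ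
  length≤∑occurrences []                          = z≤n
  length≤∑occurrences (cl@((i₁ , _) , (i₂ , _)) ∷ ψ) =
    subst (suc (length ψ) ≤_) (sym (∑-distrib-+ n _ _))
      (+-mono-≤ (≤-trans (≤-reflexive i₁-occurs) (term≤∑ n (λ j → bool-to-ℕ (occursAt j cl)) (toℕ<n i₁)))
                (length≤∑occurrences ψ))
    where
    i₁-occurs : 1 ≡ bool-to-ℕ (occursAt (toℕ i₁) cl)
    i₁-occurs = cong (λ b → bool-to-ℕ (b ∨ (toℕ i₁ ≡ᵇ toℕ i₂))) (sym (≡ᵇ-refl (toℕ i₁)))

  m≤3n : OccursAtMostThrice → m ≤ 3 * n
  m≤3n occ≤3 = begin
    m                              ≤⟨ length≤∑occurrences φ ⟩
    ∑[ j < n ] occurrencesAt j φ   ≤⟨ ∑-mono n (λ j j<n → occurrencesAt≤3 occ≤3 j<n) ⟩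
    ∑[ j < n ] 3                   ≡⟨ ∑-const n 3 ⟩
    n * 3                          ≡⟨ *-comm n 3 ⟩
    3 * n                          ∎
    where open ≤-Reasoning

  n+numSatisfied≤∑weight : OccursAtMostThrice → ∀ N → 6 * n + m ≤ N → n + numSatisfied α φ ≤ ∑[ q < N ] weight (roleOfRank n m q)
  n+numSatisfied≤∑weight occ≤3 N 6n+m≤N = begin
    n + numSatisfied α φ          ≡⟨ cong₂ _+_ (sym variables-weight) (sym (clauses-weight occ≤3)) ⟩
    ∑[ i < 3 * n ] w (3 * n + i) + ∑[ c < m ] w (6 * n + c)
                                  ≤⟨ +-monoˡ-≤ _ (∑-suffix (3 * n) (3 * n) w) ⟩
    ∑< (3 * n + 3 * n) w + ∑[ c < m ] w (6 * n + c)
                                  ≡⟨ cong (λ k → ∑< k w + ∑[ c < m ] w (6 * n + c)) (sym 6n≡3n+3n) ⟩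
    ∑< (6 * n) w + ∑[ c < m ] w (6 * n + c)   ≡⟨ ∑-split (6 * n) m w ⟨
    ∑< (6 * n + m) w              ≤⟨ ∑-prefix (6 * n + m) (N ∸ (6 * n + m)) w ⟩
    ∑< (6 * n + m + (N ∸ (6 * n + m))) w      ≡⟨ cong (λ k → ∑< k w) (m+[n∸m]≡n 6n+m≤N) ⟩
    ∑< N w                        ∎
    where
    open ≤-Reasoning
    w : ℕ → ℕ
    w q = weight (roleOfRank n m q)

  value-one : ∀ {A B} → setOne φ A B ∨ setOne φ B A ≡ true → roleValue φ A B ≡ + 1
  value-one one≡ rewrite one≡ = refl

  value-zero : ∀ {A B} → setZero A B ∨ setZero B A ≡ true → + 0 ℤ.≤ roleValue φ A B
  value-zero {A} {B} zero≡ with setOne φ A B ∨ setOne φ B A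
  ... | true  = ℤ.+≤+ z≤n
  ... | false rewrite zero≡ = ℤ.+≤+ z≤n

  value-neutral : ∀ {A B} → isDorX A ∨ isDorX B ≡ false → + 0 ℤ.≤ roleValue φ A B
  value-neutral {A} {B} neutral≡ with setOne φ A B ∨ setOne φ B A
  ... | true  = ℤ.+≤+ z≤n
  ... | false with setZero A B ∨ setZero B A
  ...   | true  = ℤ.+≤+ z≤n
  ...   | false rewrite neutral≡ = ℤ.+≤+ z≤n

  pays-neutral : ∀ {A B X} → isDorX A ≡ false → isDorX B ≡ false → weight X ≡ 0 → + weight X ℤ.≤ roleValue φ A B
  pays-neutral {A} {B} neutral-A neutral-B weightless rewrite weightless = value-neutral {A} {B} (cong₂ _∨_ neutral-A neutral-B)

  pays-zero : ∀ {A B X} → weight X ≡ 0 → setZero A B ∨ setZero B A ≡ true → + weight X ℤ.≤ roleValue φ A B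
  pays-zero {A} {B} weightless zero≡ rewrite weightless = value-zero {A} {B} zero≡

  pays-one : ∀ {A B X} → setOne φ A B ∨ setOne φ B A ≡ true → + weight X ℤ.≤ roleValue φ A B
  pays-one {A} {B} {X} one≡ rewrite value-one {A} {B} one≡ = ℤ.+≤+ (weight≤1 X)

  literal-neutral : ∀ b j → isDorX (literal b j) ≡ false
  literal-neutral true  _ = refl
  literal-neutral false _ = refl

  trueLiteral-weightless : ∀ j → weight (trueLiteral j) ≡ 0
  trueLiteral-weightless j with valueOf j in v≡
  ... | true  rewrite v≡ = refl
  ... | false rewrite v≡ = refl

  var-literal-one : ∀ b j → setOne φ (var j) (literal b j) ∨ setOne φ (literal b j) (var j) ≡ true
  var-literal-one true  j = cong (_∨ false) (≡ᵇ-refl j)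
  var-literal-one false j = cong (_∨ false) (≡ᵇ-refl j)

  -- The seeding

  module BlockSeeding (r : ℕ) (occ≤3 : OccursAtMostThrice) (16n≤N : 16 * n ≤ 2 ^ (r + 4)) where

    N : ℕ
    N = 2 ^ (r + 4)

    -- Tφ gives player a the role of rank N ∸ 1 ∸ a: the stronger the player, the smaller its rank.
    opposite : ℕ → ℕ
    opposite x = N ∸ 1 ∸ x

    role : ℕ → Role
    role a = roleOfRank n m (opposite a)

    open Tournament (Tφ φ (r + 4))
    open Weighted (weight ∘ role)

    opposite-involutive : ∀ {x} → x < N → opposite (opposite x) ≡ x
    opposite-involutive = mirror-involutive

    opposite<N : ∀ {x} → x < N → opposite x < N
    opposite<N = mirror-<

    opposite-reflects-< : ∀ {a b} → opposite a < opposite b → b < a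
    opposite-reflects-< {a} {b} lt = ≰⇒> λ b≤a → <⇒≱ lt (∸-monoʳ-≤ (N ∸ 1) b≤a)

    opposite-< : ∀ {q q′} → q < q′ → q′ < N → opposite q′ < opposite q
    opposite-< = mirror-antitone

    role-opposite : ∀ {q} → q < N → role (opposite q) ≡ roleOfRank n m q
    role-opposite q<N = cong (roleOfRank n m) (opposite-involutive q<N)

    6n+m+4n≤N : 6 * n + m + 4 * n ≤ N
    6n+m+4n≤N = begin
      6 * n + m + 4 * n      ≤⟨ +-monoˡ-≤ (4 * n) (+-monoʳ-≤ (6 * n) (m≤3n occ≤3)) ⟩
      6 * n + 3 * n + 4 * n  ≡⟨ cong (_+ 4 * n) (*-distribʳ-+ n 6 3) ⟨
      9 * n + 4 * n          ≡⟨ *-distribʳ-+ n 9 4 ⟨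
      13 * n                 ≤⟨ *-monoˡ-≤ n (m≤m+n 13 3) ⟩
      16 * n                 ≤⟨ 16n≤N ⟩
      N                      ∎
      where open ≤-Reasoning

    6n+m≤N : 6 * n + m ≤ N
    6n+m≤N = ≤-trans (m≤m+n _ _) 6n+m+4n≤N

    seat<N : ∀ {q p} → seat q ≡ just p → p < N
    seat<N seat≡ = <-≤-trans (seat<16n seat≡) 16n≤N

    extension : Σ (Permutation N N) λ σ → ∀ (a : Fin N) {p} → seat (opposite (toℕ a)) ≡ just p → toℕ (σ ⟨$⟩ʳ a) ≡ p
    extension = extend-to-permutation (seat ∘ opposite) (λ _ → seat<N) λ a<N b<N seat≡ seat≡′ →
      trans (sym (opposite-involutive a<N)) (trans (cong opposite (seat-injective seat≡ seat≡′)) (opposite-involutive b<N))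

    σ : Permutation N N
    σ = proj₁ extension

    occupant : ℕ → ℕ
    occupant p with p <? N
    ... | yes p<N = toℕ (σ ⟨$⟩ˡ fromℕ< p<N)
    ... | no _    = 0

    occupant-fromℕ< : ∀ {p} (p<N : p < N) → occupant p ≡ toℕ (σ ⟨$⟩ˡ fromℕ< p<N)
    occupant-fromℕ< {p} p<N with p <? N
    ... | yes _  = refl
    ... | no p≮N = contradiction p<N p≮N

    occupant<N : ∀ {p} → p < N → occupant p < N
    occupant<N p<N = subst (_< N) (sym (occupant-fromℕ< p<N)) (toℕ<n _)

    occupant-seated : ∀ {q p} → q < N → seat q ≡ just p → occupant p ≡ opposite q
    occupant-seated {q} {p} q<N seat≡ = begin
      occupant p                  ≡⟨ occupant-fromℕ< p<N ⟩
      toℕ (σ ⟨$⟩ˡ fromℕ< p<N)     ≡⟨ cong (toℕ ∘ (σ ⟨$⟩ˡ_)) σa≡p ⟨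
      toℕ (σ ⟨$⟩ˡ (σ ⟨$⟩ʳ a))     ≡⟨ cong toℕ (inverseˡ σ) ⟩
      toℕ a                       ≡⟨ toℕ-fromℕ< (opposite<N q<N) ⟩
      opposite q                  ∎
      where
      open ≡-Reasoning
      p<N = seat<N seat≡
      a : Fin N
      a = fromℕ< (opposite<N q<N)
      σa≡p : σ ⟨$⟩ʳ a ≡ fromℕ< p<N
      σa≡p = toℕ-injective (trans (proj₂ extension a (trans (cong (seat ∘ opposite) (toℕ-fromℕ< (opposite<N q<N)))
                                                          (trans (cong seat (opposite-involutive q<N)) seat≡)))
                                  (sym (toℕ-fromℕ< p<N)))

    occupant-seat : ∀ {p} → p < N → seat (opposite (occupant p)) ≡ just p ⊎ seat (opposite (occupant p)) ≡ nothing
    occupant-seat {p} p<N with seat (opposite (occupant p)) in seat≡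
    ... | nothing = inj₂ refl
    ... | just p′ = inj₁ (cong just (begin
      p′                          ≡⟨ proj₂ extension a (subst (λ x → seat (opposite x) ≡ just p′) (occupant-fromℕ< p<N) seat≡) ⟨
      toℕ (σ ⟨$⟩ʳ a)              ≡⟨ cong toℕ (inverseʳ σ) ⟩
      toℕ (fromℕ< p<N)            ≡⟨ toℕ-fromℕ< p<N ⟩
      p                           ∎))
      where
      open ≡-Reasoning
      a = σ ⟨$⟩ˡ fromℕ< p<N

    Plain Weak IsDummy : ℕ → Set
    Plain   a = isDorX (role a) ≡ false × weight (role a) ≡ 0
    Weak    a = 2 ≤ tier (role a) × weight (role a) ≡ 0
    IsDummy a = role a ≡ dummy

    -- The possible occupants of the clause slots of block j.
    DesignatedTo Challenger : ℕ → ℕ → Set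
    DesignatedTo j a = Σ ℕ λ c → role a ≡ clause c × setOne φ (clause c) (trueLiteral j) ≡ true
    Challenger   j a = Weak a ⊎ DesignatedTo j a

    neutral-if-weak : ∀ R → 2 ≤ tier R → isDorX R ≡ false
    neutral-if-weak (clause _) _ = refl
    neutral-if-weak dummy      _ = refl
    neutral-if-weak (var _)    (s≤s ())
    neutral-if-weak (varT _)   (s≤s ())
    neutral-if-weak (varF _)   (s≤s ())
    neutral-if-weak (d _)      ()
    neutral-if-weak (dhat _)   ()
    neutral-if-weak (dtil _)   ()

    Weak⇒Plain : ∀ a → Weak a → Plain a
    Weak⇒Plain a (2≤tier , weightless) = neutral-if-weak (role a) 2≤tier , weightless

    IsDummy⇒Weak : ∀ a → IsDummy a → Weak a
    IsDummy⇒Weak _ role≡ rewrite role≡ = m≤m+n 2 1 , refl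

    IsDummy⇒Plain : ∀ a → IsDummy a → Plain a
    IsDummy⇒Plain a isDummy = Weak⇒Plain a (IsDummy⇒Weak a isDummy)

    beats : ∀ {r a b} (R : ℕ → Set) → b < a → + weight (role b) ℤ.≤ roleValue φ (role a) (role b) → R a →
            Pays r a b × R (a ⊔ b)
    beats R b<a pays Ra rewrite m≥n⇒m⊓n≡n (<⇒≤ b<a) | m≥n⇒m⊔n≡m (<⇒≤ b<a) = pays , Ra

    loses : ∀ {r a b} (R : ℕ → Set) → a < b → + weight (role a) ℤ.≤ roleValue φ (role a) (role b) → R b →
            Pays r a b × R (a ⊔ b)
    loses R a<b pays Rb rewrite m≤n⇒m⊓n≡m (<⇒≤ a<b) | m≤n⇒m⊔n≡n (<⇒≤ a<b) = pays , Rb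

    plain-match : ∀ {P} → (∀ a → P a → Plain a) → Match P P P
    plain-match {P} plain = match λ {r} {a} {b} → play {r} {a} {b}
      where
      play : ∀ {r a b} → P a → P b → Pays r a b × P (a ⊔ b)
      play {a = a} {b} Pa Pb with plain a Pa | plain b Pb | ≤-total a b
      ... | neutral-a , weightless-a | neutral-b , _ | inj₁ a≤b rewrite m≤n⇒m⊓n≡m a≤b | m≤n⇒m⊔n≡n a≤b =
        pays-neutral {role a} {role b} {role a} neutral-a neutral-b weightless-a , Pb
      ... | neutral-a , _ | neutral-b , weightless-b | inj₂ b≤a rewrite m≥n⇒m⊓n≡n b≤a | m≥n⇒m⊔n≡m b≤a =
        pays-neutral {role a} {role b} {role b} neutral-a neutral-b weightless-b , Pa

    challenger-match : ∀ {j} → Match (Challenger j) IsDummy (Challenger j)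
    challenger-match {j} = match λ {r} {a} {b} → play {r} {a} {b}
      where
      play : ∀ {r a b} → Challenger j a → IsDummy b → Pays r a b × Challenger j (a ⊔ b)
      play {r} {a} {b} (inj₁ weak) isDummy =
        map₂ inj₁ (Match.play (plain-match Weak⇒Plain) {r} {a} {b} weak (IsDummy⇒Weak b isDummy))
      play {r} {a} {b} (inj₂ (c , role≡ , one)) isDummy =
        beats {r} (Challenger j) (opposite-reflects-< {a} {b} (<-≤-trans (rank-of-clause role≡) (rank-of-dummy isDummy)))
              (pays-neutral {role a} {role b} {role b} (cong isDorX role≡) (cong isDorX isDummy) (cong weight isDummy))
              (inj₂ (c , role≡ , one))

    module VariableBlock (j : ℕ) (j<n : j < n) where

      G : ℕ → ℕ
      G = shift (j * 16) occupant

      rank<N : ∀ {q} → q < 6 * n → q < N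
      rank<N q<6n = <-≤-trans q<6n (≤-trans (m≤m+n (6 * n) m) 6n+m≤N)

      dRank<N : ∀ {t} → t < 3 → t + j * 3 < N
      dRank<N t<3 = rank<N (<-≤-trans (dRank<3n t<3 j<n) 3n≤6n)

      xRank<N : ∀ {t} → t < 3 → 3 * n + (t + j * 3) < N
      xRank<N t<3 = rank<N (xRank<6n t<3 j<n)

      dummyRank<N : ∀ {t} → t < 4 → 6 * n + m + (t + j * 4) < N
      dummyRank<N {t} t<4 = <-≤-trans (+-monoʳ-< (6 * n + m) (subst (t + j * 4 <_) (*-comm n 4) (divMod-bound t<4 j<n))) 6n+m+4n≤N

      G-seated : ∀ {s q} → q < N → seat q ≡ just (s + j * 16) → G s ≡ opposite q
      G-seated {s} q<N seat≡ = occupant-seated q<N (trans seat≡ (cong just (+-comm s (j * 16))))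

      Dh D Dt X Lf Lt : ℕ
      Dh = opposite (0 + j * 3)
      D  = opposite (1 + j * 3)
      Dt = opposite (2 + j * 3)
      X  = opposite (3 * n + (0 + j * 3))
      Lf = opposite (3 * n + (literalOffset (not (valueOf j)) + j * 3))
      Lt = opposite (3 * n + (literalOffset (valueOf j) + j * 3))

      at-Dh : G 4 ≡ Dh
      at-Dh = G-seated (dRank<N (<ᵇ⇒< 0 3 _)) (seat-dhat j<n)
      at-D : G 0 ≡ D
      at-D = G-seated (dRank<N (<ᵇ⇒< 1 3 _)) (seat-d j<n)
      at-Dt : G 1 ≡ Dt
      at-Dt = G-seated (dRank<N (<ᵇ⇒< 2 3 _)) (seat-dtil j<n)
      at-X : G 2 ≡ X
      at-X = G-seated (xRank<N (<ᵇ⇒< 0 3 _)) (seat-var j<n)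
      at-Lf : G 3 ≡ Lf
      at-Lf = G-seated (xRank<N (literalOffset<3 _)) (seat-falseLiteral j<n)
      at-Lt : G 8 ≡ Lt
      at-Lt = G-seated (xRank<N (literalOffset<3 _)) (seat-trueLiteral j<n)

      dummy-at : ∀ t → t < 4 → IsDummy (G (dummySlot t))
      dummy-at t t<4 = begin
        role (G (dummySlot t))                       ≡⟨ cong role (G-seated (dummyRank<N t<4) (seat-dummy t<4 j<n)) ⟩
        role (opposite (6 * n + m + (t + j * 4)))    ≡⟨ role-opposite (dummyRank<N t<4) ⟩
        roleOfRank n m (6 * n + m + (t + j * 4))     ≡⟨ roleOfRank-dummy (m≤m+n _ _) ⟩
        dummy                                        ∎
        where open ≡-Reasoning

      slot<N : ∀ {s} → s < 16 → j * 16 + s < N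
      slot<N {s} s<16 = <-≤-trans (subst₂ _<_ (+-comm s (j * 16)) (*-comm n 16) (divMod-bound s<16 j<n)) 16n≤N

      slot-cases : ∀ {s} → s < 16 → (Σ ℕ λ q → Seated j s q × G s ≡ opposite q × q < N) ⊎ Weak (G s)
      slot-cases {s} s<16 with occupant-seat (slot<N s<16)
      ... | inj₂ unseated = inj₂ (unseated-weak (role (G s)) unseated)
      ... | inj₁ seat≡ with placement-of seat≡
      ...   | placement j′ s′ _ s′<16 p≡ seated
        with divMod-unique {j = j} {j′ = j′} s<16 s′<16 (trans (+-comm s (j * 16)) p≡)
      ...     | refl , refl = inj₁ (opposite (G s) , seated , sym (opposite-involutive G<N) , opposite<N G<N)
        where G<N = occupant<N (slot<N s<16)

      weak-slot : ∀ {s} → s < 16 → (∀ {q} → ¬ Seated j s q) → Weak (G s)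
      weak-slot s<16 unseatable with slot-cases s<16
      ... | inj₁ (_ , seated , _) = contradiction seated unseatable
      ... | inj₂ weak             = weak

      challenger-slot : ∀ {s} → s < 16 → (∀ {q} → Seated j s q → Σ ℕ λ c → c < m × q ≡ 6 * n + c × designeeOf c ≡ just j) →
                        Challenger j (G s)
      challenger-slot {s} s<16 clause-seated with slot-cases s<16
      ... | inj₂ weak = inj₁ weak
      ... | inj₁ (q , seated , G≡ , q<N) with clause-seated seated
      ...   | c , c<m , refl , des≡ = inj₂ (c , role≡ , designee-setOne des≡)
        where
        role≡ : role (G s) ≡ clause c
        role≡ = trans (cong role G≡) (trans (role-opposite q<N) (roleOfRank-clause c<m))

      role-Dh : role Dh ≡ dhat j
      role-Dh = trans (role-opposite (dRank<N (<ᵇ⇒< 0 3 _))) (roleOfRank-d (<ᵇ⇒< 0 3 _) j<n)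
      role-D : role D ≡ d j
      role-D = trans (role-opposite (dRank<N (<ᵇ⇒< 1 3 _))) (roleOfRank-d (<ᵇ⇒< 1 3 _) j<n)
      role-Dt : role Dt ≡ dtil j
      role-Dt = trans (role-opposite (dRank<N (<ᵇ⇒< 2 3 _))) (roleOfRank-d (<ᵇ⇒< 2 3 _) j<n)
      role-X : role X ≡ var j
      role-X = trans (role-opposite (xRank<N (<ᵇ⇒< 0 3 _))) (roleOfRank-x (<ᵇ⇒< 0 3 _) j<n)
      role-Lf : role Lf ≡ falseLiteral j
      role-Lf = trans (role-opposite (xRank<N (literalOffset<3 _))) (roleOfRank-literal _ j<n)
      role-Lt : role Lt ≡ trueLiteral j
      role-Lt = trans (role-opposite (xRank<N (literalOffset<3 _))) (roleOfRank-literal _ j<n)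

      Dt<D : Dt < D
      Dt<D = opposite-< ≤-refl (dRank<N (<ᵇ⇒< 2 3 _))
      Lf<X : Lf < X
      Lf<X = opposite-< (+-monoʳ-< (3 * n) (+-monoˡ-< (j * 3) (0<literalOffset (not (valueOf j))))) (xRank<N (literalOffset<3 _))
        where 0<literalOffset : ∀ b → 0 < literalOffset b
              0<literalOffset true  = s≤s z≤n
              0<literalOffset false = s≤s z≤n
      X<D : X < D
      X<D = opposite-< (<-≤-trans (dRank<3n (<ᵇ⇒< 1 3 _) j<n) (m≤m+n _ _)) (xRank<N (<ᵇ⇒< 0 3 _))
      D<Dh : D < Dh
      D<Dh = opposite-< ≤-refl (dRank<N (<ᵇ⇒< 1 3 _))
      Lt<Dh : Lt < Dh
      Lt<Dh = opposite-< (<-≤-trans (dRank<3n (<ᵇ⇒< 0 3 _) j<n) (m≤m+n _ _)) (xRank<N (literalOffset<3 _))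
      weak<Dh : ∀ {b} → Weak b → b < Dh
      weak<Dh {b} (2≤tier , _) = opposite-reflects-< {Dh} {b}
        (subst (_< opposite b) (sym (opposite-involutive (dRank<N (<ᵇ⇒< 0 3 _))))
               (<-≤-trans (dRank<3n (<ᵇ⇒< 0 3 _) j<n) (≤-trans 3n≤6n (6n≤rank 2≤tier))))
      challenger<Lt : ∀ {b} → Challenger j b → b < Lt
      challenger<Lt {b} challenger = opposite-reflects-< {Lt} {b}
        (subst (_< opposite b) (sym (opposite-involutive (xRank<N (literalOffset<3 _))))
               (<-≤-trans (xRank<6n (literalOffset<3 _) j<n) (6n≤rank (2≤tier challenger))))
        where
        2≤tier : Challenger j b → 2 ≤ tier (role b)
        2≤tier (inj₁ (2≤tier , _))     = 2≤tier
        2≤tier (inj₂ (_ , role≡ , _)) = subst (λ R → 2 ≤ tier R) (sym role≡) ≤-refl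

      PaysAs : Role → Role → Role → Set
      PaysAs A B X = + weight X ℤ.≤ roleValue φ A B

      d-beats-dtil : Match (_≡ D) (_≡ Dt) (_≡ D)
      d-beats-dtil = match λ { {r} refl refl → beats {r} (_≡ D) Dt<D
        (subst₂ (λ A B → PaysAs A B B) (sym role-D) (sym role-Dt)
                (pays-zero {d j} {dtil j} {dtil j} refl (cong (_∨ false) (≡ᵇ-refl j)))) refl }

      var-beats-falseLiteral : Match (_≡ X) (_≡ Lf) (_≡ X)
      var-beats-falseLiteral = match λ { {r} refl refl → beats {r} (_≡ X) Lf<X
        (subst₂ (λ A B → PaysAs A B B) (sym role-X) (sym role-Lf)
                (pays-one {var j} {falseLiteral j} {falseLiteral j} (var-literal-one (not (valueOf j)) j))) refl }

      d-beats-var : Match (_≡ D) (_≡ X) (_≡ D)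
      d-beats-var = match λ { {r} refl refl → beats {r} (_≡ D) X<D
        (subst₂ (λ A B → PaysAs A B B) (sym role-D) (sym role-X)
                (pays-zero {d j} {var j} {var j} refl (cong (_∨ false) (≡ᵇ-refl j)))) refl }

      dhat-beats-weak : Match (_≡ Dh) Weak (_≡ Dh)
      dhat-beats-weak = match λ { {r} {b = b} refl weak@(2≤tier , weightless) → beats {r} (_≡ Dh) (weak<Dh weak)
        (subst (λ A → PaysAs A (role b) (role b)) (sym role-Dh)
               (pays-neutral {dhat j} {role b} {role b} refl (neutral-if-weak (role b) 2≤tier) weightless)) refl }

      dhat-beats-d : Match (_≡ D) (_≡ Dh) (_≡ Dh)
      dhat-beats-d = match λ { {r} refl refl → loses {r} (_≡ Dh) D<Dh
        (subst₂ (λ A B → PaysAs A B A) (sym role-D) (sym role-Dh)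
                (pays-zero {d j} {dhat j} {d j} refl (cong (_∨ false) (≡ᵇ-refl j)))) refl }

      trueLiteral-beats-challenger : Match (_≡ Lt) (Challenger j) (_≡ Lt)
      trueLiteral-beats-challenger = match λ {r} {a} {b} → play {r} {a} {b}
        where
        play : ∀ {r a b} → a ≡ Lt → Challenger j b → Pays r a b × a ⊔ b ≡ Lt
        play {r} {b = b} refl (inj₁ weak@(2≤tier , weightless)) = beats {r} (_≡ Lt) (challenger<Lt (inj₁ weak))
          (subst (λ A → PaysAs A (role b) (role b)) (sym role-Lt)
                 (pays-neutral {trueLiteral j} {role b} {role b}
                               (literal-neutral _ j) (neutral-if-weak (role b) 2≤tier) weightless)) refl
        play {r} refl (inj₂ designated@(c , role≡ , one)) = beats {r} (_≡ Lt) (challenger<Lt (inj₂ designated))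
          (subst₂ (λ A B → PaysAs A B B) (sym role-Lt) (sym role≡)
                  (pays-one {trueLiteral j} {clause c} {clause c}
                            (trans (cong (setOne φ (trueLiteral j) (clause c) ∨_) one) (∨-zeroʳ _)))) refl

      dhat-beats-trueLiteral : Match (_≡ Dh) (_≡ Lt) (_≡ Dh)
      dhat-beats-trueLiteral = match λ { {r} refl refl → beats {r} (_≡ Dh) Lt<Dh
        (subst₂ (λ A B → PaysAs A B B) (sym role-Dh) (sym role-Lt)
                (pays-neutral {dhat j} {trueLiteral j} {trueLiteral j} refl (literal-neutral _ j) (trueLiteral-weightless j))) refl }

      half-Dh : Bracket 3 G (_≡ Dh)
      half-Dh =
        join dhat-beats-d
          (join d-beats-var
             (join d-beats-dtil (leaf at-D) (leaf at-Dt))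
             (join var-beats-falseLiteral (leaf at-X) (leaf at-Lf)))
          (join dhat-beats-weak
             (join dhat-beats-weak (leaf at-Dh) (leaf (weak-slot (<ᵇ⇒< 5 16 _) λ ())))
             (join (plain-match Weak⇒Plain) (leaf (weak-slot (<ᵇ⇒< 6 16 _) λ ())) (leaf (weak-slot (<ᵇ⇒< 7 16 _) λ ()))))

      half-Lt : Bracket 3 (shift 8 G) (_≡ Lt)
      half-Lt =
        join trueLiteral-beats-challenger
          (join trueLiteral-beats-challenger
             (join trueLiteral-beats-challenger (leaf at-Lt)
                (leaf (challenger-slot (<ᵇ⇒< 9 16 _) λ { (clause-seat₀ c<m des≡ _) → _ , c<m , refl , des≡ })))
             (join challenger-match
                (leaf (challenger-slot (<ᵇ⇒< 10 16 _) λ { (clause-seat₁ c<m des≡ _) → _ , c<m , refl , des≡ }))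
                (leaf (dummy-at 0 (<ᵇ⇒< 0 4 _)))))
          (join challenger-match
             (join challenger-match
                (leaf (challenger-slot (<ᵇ⇒< 12 16 _) λ { (clause-seat₂ c<m des≡ _) → _ , c<m , refl , des≡ }))
                (leaf (dummy-at 1 (<ᵇ⇒< 1 4 _))))
             (join (plain-match IsDummy⇒Plain) (leaf (dummy-at 2 (<ᵇ⇒< 2 4 _))) (leaf (dummy-at 3 (<ᵇ⇒< 3 4 _)))))

      bracket-won-by-Dh : Bracket 4 G (_≡ Dh)
      bracket-won-by-Dh = join dhat-beats-trueLiteral half-Dh half-Lt

    position<N : ∀ {b i} → b < 2 ^ r → i < 16 → b * 16 + i < N
    position<N {b} {i} b<2^r i<16 = begin-strict
      b * 16 + i  ≡⟨ +-comm (b * 16) i ⟩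
      i + b * 16  <⟨ divMod-bound i<16 b<2^r ⟩
      2 ^ r * 16  ≡⟨ ^-distribˡ-+-* 2 r 4 ⟨
      N           ∎
      where open ≤-Reasoning

    block-bracket : ∀ b → b < 2 ^ r → Bracket 4 (shift (b * 16) occupant) Plain
    block-bracket b b<2^r with b <? n
    ... | yes b<n = Bracket-map (λ _ champion≡ → subst Plain (sym champion≡) Dh-plain) (VariableBlock.bracket-won-by-Dh b b<n)
      where
      Dh-plain : Plain (VariableBlock.Dh b b<n)
      Dh-plain = let role≡ = VariableBlock.role-Dh b b<n in cong isDorX role≡ , cong weight role≡
    ... | no b≮n  = Bracket-map Weak⇒Plain (join-blocks 4 0 (plain-match Weak⇒Plain) λ i i<16 → leaf (unseated i i<16))
      where
      unseated : ∀ i → i < 16 → Weak (occupant (b * 16 + (i * 1 + 0)))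
      unseated i i<16 with occupant-seat (position<N b<2^r (subst (_< 16) (sym i*1+0≡i) i<16))
        where i*1+0≡i = trans (+-identityʳ (i * 1)) (*-identityʳ i)
      ... | inj₂ seat≡ = unseated-weak _ seat≡
      ... | inj₁ seat≡ = contradiction (seat<16n seat≡) (≤⇒≯ (≤-trans 16n≤16b (m≤m+n _ _)))
        where 16n≤16b = ≤-trans (≤-reflexive (*-comm 16 n)) (*-monoˡ-≤ 16 (≮⇒≥ b≮n))

    seeding-bracket : Bracket (r + 4) occupant Plain
    seeding-bracket = join-blocks r 4 (plain-match λ _ plain → plain) block-bracket

    occupant-toℕ : ∀ (i : Fin N) → toℕ (σ ⟨$⟩ˡ i) ≡ occupant (toℕ i)
    occupant-toℕ i = trans (cong (toℕ ∘ (σ ⟨$⟩ˡ_)) (sym (fromℕ<-toℕ i (toℕ<n i)))) (sym (occupant-fromℕ< (toℕ<n i)))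

    ∑weight-seated : ∑[ p < N ] weight (role (occupant p)) ≡ ∑[ q < N ] weight (roleOfRank n m q)
    ∑weight-seated = begin
      ∑[ p < N ] weight (role (occupant p))
        ≡⟨ ∑-fin N {h = weight ∘ role ∘ occupant} (λ i → cong (weight ∘ role) (occupant-toℕ i)) ⟨
      FinSum.sum {N} (λ i → weight (role (toℕ (σ ⟨$⟩ˡ i))))
        ≡⟨ FinSum.sum-permute {N} (λ a → weight (role (toℕ a))) (Permutation.flip σ) ⟨
      FinSum.sum {N} (λ a → weight (role (toℕ a)))
        ≡⟨ ∑-fin N {h = weight ∘ role} (λ _ → refl) ⟩
      ∑[ a < N ] weight (role a)
        ≡⟨ ∑-cong N (λ a _ → cong (weight ∘ roleOfRank n m) (∸-+-assoc N 1 a)) ⟩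
      ∑[ a < N ] weight (roleOfRank n m (N ∸ suc a))
        ≡⟨ ∑-reverse N (weight ∘ roleOfRank n m) ⟩
      ∑[ q < N ] weight (roleOfRank n m q)
        ∎
      where open ≡-Reasoning

    k+n≤value : ∀ k → k ≤ numSatisfied α φ → + (k + n) ℤ.≤ tournamentValue (r + 4) (Tφ φ (r + 4)) σ
    k+n≤value k k≤sat = begin
      + (k + n)
        ≤⟨ ℤ.+≤+ (subst (_≤ n + numSatisfied α φ) (+-comm n k) (+-monoʳ-≤ n k≤sat)) ⟩
      + (n + numSatisfied α φ)
        ≤⟨ ℤ.+≤+ (n+numSatisfied≤∑weight occ≤3 N 6n+m≤N) ⟩
      + ∑[ q < N ] weight (roleOfRank n m q)
        ≡⟨ cong +_ ∑weight-seated ⟨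
      + ∑[ p < N ] weight (role (occupant p))
        ≤⟨ ∑weight≤value+champion (r + 4) occupant (Bracket.allPay seeding-bracket) ⟩
      value (r + 4) occupant ℤ.+ + weight (role (champion (r + 4) occupant))
        ≡⟨ cong (λ w → value (r + 4) occupant ℤ.+ + w) (proj₂ (Bracket.champion-holds seeding-bracket)) ⟩
      value (r + 4) occupant ℤ.+ + 0
        ≡⟨ ℤ.+-identityʳ _ ⟩
      value (r + 4) occupant
        ≡⟨ proj₂ (winner≡champion×blockValue≡value (r + 4) occupant-toℕ) ⟨
      tournamentValue (r + 4) (Tφ φ (r + 4)) σ
        ∎
      where open ℤ.≤-Reasoning

exponent≥4 : ∀ {e} → 16 ≤ 2 ^ e → 4 ≤ e
exponent≥4 16≤2^e = ≮⇒≥ λ e<4 → <⇒≱ (≤-<-trans (^-monoʳ-≤ 2 (s≤s⁻¹ e<4)) (<ᵇ⇒< 8 16 _)) 16≤2^e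


lemma3 : (n : ℕ) (φ : Formula n) → IsMax23SAT φ →
    (k : ℕ) → (α : Assignment n) → k ≤ numSatisfied α φ →
    (n' : ℕ) → IsSmallestExp n n' →
    Σ (Seeding n') (λ σ → (+ (k + n)) ℤ.≤ tournamentValue n' (Tφ φ n') σ)
lemma3 zero (((() , _) , _) ∷ _) _ _ _ _ _ _
lemma3 zero [] _ k _ k≤0 zero _ rewrite n≤0⇒n≡0 k≤0 = Permutation.id , ℤ.+≤+ z≤n
lemma3 zero [] _ _ _ _ (suc _) (_ , minimal) with () ← minimal 0 (s≤s z≤n)
lemma3 (suc n-1) φ (_ , occ≤3) k α k≤sat n' (16n≤2^n' , _) =
  subst (λ e → Σ (Seeding e) λ σ → + (k + suc n-1) ℤ.≤ tournamentValue e (Tφ φ e) σ) n'≡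
        (σ , k+n≤value k k≤sat)
  where
  4≤n' = exponent≥4 (≤-trans (m≤m*n 16 (suc n-1)) 16n≤2^n')
  n'≡ : n' ∸ 4 + 4 ≡ n'
  n'≡ = m∸n+n≡m 4≤n'
  open Construction.BlockSeeding φ α (n' ∸ 4) occ≤3 (subst (λ e → 16 * suc n-1 ≤ 2 ^ e) (sym n'≡) 16n≤2^n')
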